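{- Fix a positive integer $n$. As $q\to\infty$ over prime powers, the number of pairs $(F,G)$ of polynomials in $\mathbb{F}_q[T]$ with $\deg(F)=\deg(G)=n$ and $\widetilde{\varphi}(F)=\widetilde{\sigma}(G)$ is $\gg q^n/n^2$.
   Context: For nonzero $F\in\mathbb{F}_q[T]$, $\widetilde{\sigma}(F)=\sum_{D\mid F}D\in\mathbb{F}_q[T]$, the sum over monic divisors $D$ of $F$, and $\widetilde{\varphi}(F)=\prod_{P\mid F}P^{v_P(F)-1}(P-1)\in\mathbb{F}_q[T]$, the product over monic irreducible polynomials $P$ dividing $F$, with $v_P(F)$ the exponent of $P$ in $F$. -}

module Defs where

open import Level using (0ℓ)
open import Data.Nat as ℕ using (ℕ; zero; suc; _∸_)
open import Data.Bool using (Bool; true; false; _∧_; not; if_then_else_)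
open import Data.List using (List; []; _∷_; _++_; [_]; map; foldr; length; concatMap;
  applyUpTo; upTo; filterᵇ; takeWhileᵇ; cartesianProduct)
open import Data.Bool.ListAction using (any; all)
open import Data.Product using (∃; _×_; _,_; proj₁; proj₂)
open import Relation.Binary.PropositionalEquality using (_≡_; _≢_)
open import Relation.Binary.Definitions using (DecidableEquality)
open import Relation.Nullary using (does)
open import Algebra.Structures using (IsCommutativeRing)
open import Data.List.Membership.Propositional using (_∈_)
open import Data.List.Relation.Unary.Unique.Propositional using (Unique)

record FiniteField : Set₁ where
  infixl 7 _*_
  infixl 6 _+_
  field
    Carrier : Set
    _+_ _*_ : Carrier → Carrier → Carrier
    -_      : Carrier → Carrier
    0# 1#   : Carrier
    isCommutativeRing : IsCommutativeRing _≡_ _+_ _*_ -_ 0# 1#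
    0≢1     : 0# ≢ 1#
    inverse : ∀ x → x ≢ 0# → ∃ λ y → x * y ≡ 1#
    _≟_     : DecidableEquality Carrier
    elems   : List Carrier
    elems-complete : ∀ x → x ∈ elems
    elems-unique   : Unique elems

  size : ℕ
  size = length elems

-- Polynomials in 𝔽[T] as little-endian coefficient lists
-- (trailing zero coefficients allowed; equality is up to them).

module Poly (𝔽 : FiniteField) where
  open FiniteField 𝔽

  Pol : Set
  Pol = List Carrier

  _==_ : Carrier → Carrier → Bool
  a == b = does (a ≟ b)

  addP : Pol → Pol → Pol
  addP [] ys = ys
  addP xs [] = xs
  addP (x ∷ xs) (y ∷ ys) = (x + y) ∷ addP xs ys

  negP : Pol → Pol
  negP = map -_

  scalP : Carrier → Pol → Pol
  scalP a = map (a *_)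

  mulP : Pol → Pol → Pol
  mulP [] ys = []
  mulP (x ∷ xs) ys = addP (scalP x ys) (0# ∷ mulP xs ys)

  oneP : Pol
  oneP = [ 1# ]

  powP : Pol → ℕ → Pol
  powP P zero = oneP
  powP P (suc k) = mulP P (powP P k)

  isZeroP : Pol → Bool
  isZeroP = all (_== 0#)

  eqP : Pol → Pol → Bool
  eqP xs ys = isZeroP (addP xs (negP ys))

  norm : Pol → Pol
  norm [] = []
  norm (x ∷ xs) with norm xs
  ... | [] = if x == 0# then [] else [ x ]
  ... | y ∷ ys = x ∷ y ∷ ys

  deg : Pol → ℕ
  deg p = length (norm p) ∸ 1

  vecs : ℕ → List Pol
  vecs zero = [ [] ]
  vecs (suc k) = concatMap (λ a → map (a ∷_) (vecs k)) elems

  polysOfDeg : ℕ → List Pol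
  polysOfDeg d = concatMap (λ xs → map (λ a → xs ++ [ a ]) (filterᵇ (λ a → not (a == 0#)) elems)) (vecs d)

  monicOfDeg : ℕ → List Pol
  monicOfDeg d = map (_++ [ 1# ]) (vecs d)

  -- divisibility D ∣ F (D monic): ∃ H with D * H = F. For monic D a
  -- cofactor H, if it exists, has at most deg F - deg D + 1 coefficients,
  -- so the search below is exhaustive.
  divides : Pol → Pol → Bool
  divides D F = any (λ H → eqP (mulP D H) F) (vecs (suc (length (norm F) ∸ length (norm D))))

  monicDivisors : Pol → List Pol
  monicDivisors F = filterᵇ (λ D → divides D F) (concatMap monicOfDeg (upTo (suc (deg F))))

  sigmaT : Pol → Pol
  sigmaT G = foldr addP [] (monicDivisors G)

  isIrreducibleMonic : Pol → Bool
  isIrreducibleMonic P =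
    not (deg P ℕ.≡ᵇ 0) ∧
    all (λ d → all (λ D → not (divides D P)) (monicOfDeg d)) (applyUpTo suc (deg P ∸ 1))

  primeDivisors : Pol → List Pol
  primeDivisors F = filterᵇ (λ P → isIrreducibleMonic P ∧ divides P F)
                            (concatMap monicOfDeg (applyUpTo suc (deg F)))

  -- v_P(F) for nonzero F and monic irreducible P: the largest k with P^k ∣ F
  -- (P^1, …, P^k all divide F; k ≤ deg F)
  val : Pol → Pol → ℕ
  val P F = length (takeWhileᵇ (λ k → divides (powP P k) F) (applyUpTo suc (deg F)))

  phiT : Pol → Pol
  phiT F = foldr (λ P acc → mulP (mulP (powP P (val P F ∸ 1)) (addP P (negP oneP))) acc)
                 oneP (primeDivisors F)

  countPairs : ℕ → ℕ
  countPairs n = length (filterᵇ (λ FG → eqP (phiT (proj₁ FG)) (sigmaT (proj₂ FG)))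
                                 (cartesianProduct (polysOfDeg n) (polysOfDeg n)))

countPairs : FiniteField → ℕ → ℕ
countPairs 𝔽 = Poly.countPairs 𝔽

module Submission where

-- For a set S of n distinct field elements and units c, d put
--   F = c · ∏_{a ∈ S} (T - a),   G = d · ∏_{a ∈ S} (T - (a + 2)).
-- F is squarefree and split, so its monic prime divisors are the T - a, each with exponent 1,
-- and φ̃(F) = ∏ (T - a - 1). The monic divisors of G are its sub-products, so
-- σ̃(G) = Σ_{S' ⊆ S} ∏_{a ∈ S'} (T - a - 2) = ∏ (T - a - 1) as well. Distinct (S, c, d) give
-- distinct pairs, hence countPairs n ≥ C(q, n)·(q - 1)². Finally, with m = ⌊q/n⌋ one has
-- C(q, n) ≥ m^n and q ≤ 2nm, so q^n ≤ (2n)^n m^n ≤ (q - 1)² C(q, n) once q ≥ (2n)^n + n.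

open import Defs
open import Level using (0ℓ)
open import Data.Nat as ℕ using (ℕ; zero; suc; _∸_; _≤_; _<_; z≤n; s≤s)
import Data.Nat.Properties as ℕP
open import Data.Nat.DivMod using (_/_; _%_; m/n*n≤m; m≡m%n+[m/n]*n; m%n<n; m≥n⇒m/n>0)
open import Data.Bool using (Bool; true; false; T; not; _∧_)
open import Data.Bool.Properties using (T-∧)
open import Data.List using (List; []; _∷_; [_]; _++_; length; map; foldr; concatMap; filterᵇ; takeWhileᵇ;
  upTo; applyUpTo; cartesianProduct)
import Data.List.Properties as List
open import Data.List.Membership.Propositional using (_∈_; find)
open import Data.List.Membership.Propositional.Properties
  using (∈-map⁺; ∈-map⁻; ∈-concatMap⁺; ∈-concatMap⁻; ∈-filter⁺; ∈-filter⁻; ∈-++⁺ˡ; ∈-++⁺ʳ; ∈-++⁻;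
         ∈-upTo⁺; ∈-applyUpTo⁺; ∈-applyUpTo⁻; ∈-∃++; ∈-cartesianProduct⁺; ∈-cartesianProduct⁻)
open import Data.List.Membership.Propositional.Properties.WithK using (unique∧set⇒bag)
open import Data.List.Relation.Unary.Any as Any using (here; there)
import Data.List.Relation.Unary.Any.Properties as Any
open import Data.List.Relation.Unary.All as All using (All; []; _∷_)
import Data.List.Relation.Unary.All.Properties as All
open import Data.List.Relation.Unary.AllPairs as AllPairs using ([]; _∷_)
import Data.List.Relation.Unary.AllPairs.Properties as AllPairs
open import Data.List.Relation.Unary.Unique.Propositional using (Unique)
import Data.List.Relation.Unary.Unique.Propositional.Properties as Unique
open import Data.List.Relation.Binary.Permutation.Propositional as ↭ using (_↭_)
open import Data.List.Relation.Binary.BagAndSetEquality using (∼bag⇒↭)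
open import Data.List.Relation.Binary.Disjoint.Propositional using (Disjoint)
open import Data.List.Relation.Binary.Sublist.Propositional using (_⊆_; []; _∷_; _∷ʳ_)
open import Data.List.Relation.Binary.Sublist.Propositional.Properties using (Any-resp-⊆; length-mono-≤)
open import Data.Product using (∃; ∃₂; _×_; _,_; proj₁; proj₂)
open import Data.Sum using (_⊎_; inj₁; inj₂)
open import Data.Empty using (⊥; ⊥-elim)
open import Function using (_∘_; Equivalence; mk⇔)
open import Relation.Nullary using (¬_; Dec; yes; no)
open import Relation.Nullary.Decidable using (T?)
open import Relation.Binary.Bundles using (Setoid)
open import Relation.Binary.Definitions using (tri<; tri≈; tri>)
open import Relation.Binary.PropositionalEquality
  using (_≡_; _≢_; refl; sym; trans; cong; cong₂; subst; module ≡-Reasoning)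
open import Algebra.Bundles using (CommutativeRing)

unique-length-≤ : ∀ {A : Set} {L M : List A} → Unique L → (∀ {x} → x ∈ L → x ∈ M) → length L ≤ length M
unique-length-≤ {L = []} _ _ = z≤n
unique-length-≤ {L = x ∷ L} {M} (x∉L ∷ uL) L⊆M with ∈-∃++ (L⊆M (here refl))
... | ys , zs , refl = begin
    suc (length L)              ≤⟨ s≤s (unique-length-≤ uL L⊆ys++zs) ⟩
    suc (length (ys ++ zs))     ≡⟨ cong suc (List.length-++ ys) ⟩
    suc (length ys ℕ.+ length zs) ≡⟨ sym (ℕP.+-suc (length ys) (length zs)) ⟩
    length ys ℕ.+ suc (length zs) ≡⟨ sym (List.length-++ ys) ⟩
    length (ys ++ x ∷ zs)       ∎
  where
  open ℕP.≤-Reasoning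
  drop-x : ∀ {y} us → y ∈ us ++ x ∷ zs → y ≢ x → y ∈ us ++ zs
  drop-x []       (here y≡x) y≢x = ⊥-elim (y≢x y≡x)
  drop-x []       (there y∈) _   = y∈
  drop-x (u ∷ us) (here y≡u) _   = here y≡u
  drop-x (u ∷ us) (there y∈) y≢x = there (drop-x us y∈ y≢x)
  L⊆ys++zs : ∀ {y} → y ∈ L → y ∈ ys ++ zs
  L⊆ys++zs y∈L = drop-x ys (L⊆M (there y∈L)) (λ y≡x → All.lookup x∉L y∈L (sym y≡x))

length-cartesianProduct : ∀ {A B : Set} (xs : List A) (ys : List B) →
  length (cartesianProduct xs ys) ≡ length xs ℕ.* length ys
length-cartesianProduct []       ys = refl
length-cartesianProduct (x ∷ xs) ys = trans (List.length-++ (map (x ,_) ys))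
  (cong₂ ℕ._+_ (List.length-map (x ,_) ys) (length-cartesianProduct xs ys))

unique-⊆ : ∀ {A : Set} {S xs : List A} → S ⊆ xs → Unique xs → Unique S
unique-⊆ []          u          = u
unique-⊆ (y ∷ʳ S⊆xs) (_ ∷ u)    = unique-⊆ S⊆xs u
unique-⊆ (refl ∷ S⊆xs) (y∉ ∷ u) =
  All.tabulate (λ a∈S → All.lookup y∉ (Any-resp-⊆ S⊆xs a∈S)) ∷ unique-⊆ S⊆xs u

⊆-extensional : ∀ {A : Set} {S S' xs : List A} → Unique xs → S ⊆ xs → S' ⊆ xs →
  (∀ {a} → a ∈ S → a ∈ S') → (∀ {a} → a ∈ S' → a ∈ S) → S ≡ S'
⊆-extensional u [] [] _ _ = refl
⊆-extensional (_ ∷ u) (y ∷ʳ s) (.y ∷ʳ s') to from = ⊆-extensional u s s' to from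
⊆-extensional {xs = y ∷ xs} (y∉ ∷ u) (refl ∷ s) (refl ∷ s') to from =
  cong (y ∷_) (⊆-extensional u s s' (λ a∈ → not-head (to (there a∈)) (Any-resp-⊆ s a∈))
                                    (λ a∈ → not-head (from (there a∈)) (Any-resp-⊆ s' a∈)))
  where
  not-head : ∀ {a T} → a ∈ y ∷ T → a ∈ xs → a ∈ T
  not-head (here refl) a∈xs = ⊥-elim (All.lookup y∉ a∈xs refl)
  not-head (there a∈)  _    = a∈
⊆-extensional (y∉ ∷ u) (refl ∷ s) (_ ∷ʳ s') to _ =
  ⊥-elim (All.lookup y∉ (Any-resp-⊆ s' (to (here refl))) refl)
⊆-extensional (y∉ ∷ u) (_ ∷ʳ s) (refl ∷ s') _ from =
  ⊥-elim (All.lookup y∉ (Any-resp-⊆ s (from (here refl))) refl)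

choose : ∀ {A : Set} → ℕ → List A → List (List A)
choose zero    xs       = [ [] ]
choose (suc k) []       = []
choose (suc k) (x ∷ xs) = map (x ∷_) (choose k xs) ++ choose (suc k) xs

binomial : ℕ → ℕ → ℕ
binomial q       zero    = 1
binomial zero    (suc k) = 0
binomial (suc q) (suc k) = binomial q k ℕ.+ binomial q (suc k)

length-choose : ∀ {A : Set} k (xs : List A) → length (choose k xs) ≡ binomial (length xs) k
length-choose zero    xs       = refl
length-choose (suc k) []       = refl
length-choose (suc k) (x ∷ xs) = trans (List.length-++ (map (x ∷_) (choose k xs)))
  (cong₂ ℕ._+_ (trans (List.length-map (x ∷_) (choose k xs)) (length-choose k xs)) (length-choose (suc k) xs))

choose-length : ∀ {A : Set} k (xs : List A) {S} → S ∈ choose k xs → length S ≡ k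
choose-length zero    xs       (here refl) = refl
choose-length (suc k) (x ∷ xs) S∈ with ∈-++⁻ (map (x ∷_) (choose k xs)) S∈
... | inj₂ S∈′ = choose-length (suc k) xs S∈′
... | inj₁ S∈′ with ∈-map⁻ (x ∷_) S∈′
...   | S , S∈″ , refl = cong suc (choose-length k xs S∈″)

choose-⊆ : ∀ {A : Set} k (xs : List A) {S} → S ∈ choose k xs → S ⊆ xs
choose-⊆ zero    []       (here refl) = []
choose-⊆ zero    (x ∷ xs) (here refl) = x ∷ʳ choose-⊆ zero xs (here refl)
choose-⊆ (suc k) (x ∷ xs) S∈ with ∈-++⁻ (map (x ∷_) (choose k xs)) S∈
... | inj₂ S∈′ = x ∷ʳ choose-⊆ (suc k) xs S∈′
... | inj₁ S∈′ with ∈-map⁻ (x ∷_) S∈′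
...   | S , S∈″ , refl = refl ∷ choose-⊆ k xs S∈″

choose-unique : ∀ {A : Set} k (xs : List A) → Unique xs → Unique (choose k xs)
choose-unique zero    xs       _          = [] ∷ []
choose-unique (suc k) []       _          = []
choose-unique (suc k) (x ∷ xs) (x∉ ∷ uxs) =
  Unique.++⁺ (Unique.map⁺ List.∷-injectiveʳ (choose-unique k xs uxs)) (choose-unique (suc k) xs uxs) disjoint
  where
  disjoint : ∀ {S} → S ∈ map (x ∷_) (choose k xs) × S ∈ choose (suc k) xs → ⊥
  disjoint (S∈₁ , S∈₂) with ∈-map⁻ (x ∷_) S∈₁
  ... | _ , _ , refl = All.lookup x∉ (Any-resp-⊆ (choose-⊆ (suc k) xs S∈₂) (here refl)) refl

∈-filterᵇ⁺ : ∀ {A : Set} (p : A → Bool) {x xs} → x ∈ xs → T (p x) → x ∈ filterᵇ p xs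
∈-filterᵇ⁺ p = ∈-filter⁺ (T? ∘ p)

∈-filterᵇ⁻ : ∀ {A : Set} (p : A → Bool) {x xs} → x ∈ filterᵇ p xs → x ∈ xs × T (p x)
∈-filterᵇ⁻ p = ∈-filter⁻ (T? ∘ p)

filterᵇ-unique : ∀ {A : Set} (p : A → Bool) {xs} → Unique xs → Unique (filterᵇ p xs)
filterᵇ-unique p = Unique.filter⁺ (T? ∘ p)

unique-same-members⇒↭ : ∀ {A : Set} {xs ys : List A} → Unique xs → Unique ys →
  (∀ {x} → x ∈ xs → x ∈ ys) → (∀ {x} → x ∈ ys → x ∈ xs) → xs ↭ ys
unique-same-members⇒↭ uxs uys to from = ∼bag⇒↭ (unique∧set⇒bag uxs uys (mk⇔ to from))

unique-map-injectiveOn : ∀ {A B : Set} (f : A → B) {xs} →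
  (∀ {x y} → x ∈ xs → y ∈ xs → f x ≡ f y → x ≡ y) → Unique xs → Unique (map f xs)
unique-map-injectiveOn f {[]}     _   []          = []
unique-map-injectiveOn f {x ∷ xs} inj (x∉xs ∷ u) =
  All.map⁺ (All.tabulate λ y∈ fx≡fy → All.lookup x∉xs y∈ (inj (here refl) (there y∈) fx≡fy))
  ∷ unique-map-injectiveOn f (λ x∈ y∈ → inj (there x∈) (there y∈)) u

T-not⇒¬T : ∀ {b} → T (not b) → ¬ T b
T-not⇒¬T {true} ()

takeWhile-one : ∀ (p : ℕ → Bool) m → T (p 1) → ¬ T (p 2) → length (takeWhileᵇ p (applyUpTo suc (suc m))) ≡ 1
takeWhile-one p zero    p1 _   with p 1
... | true = refl
takeWhile-one p (suc m) p1 ¬p2 with p 1 | p 2 in p2≡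
... | true | true  = ⊥-elim (¬p2 _)
... | true | false rewrite p2≡ = refl

module Polynomials (𝔽 : FiniteField) where

  open FiniteField 𝔽
  open Poly 𝔽

  ring : CommutativeRing 0ℓ 0ℓ
  ring = record { isCommutativeRing = isCommutativeRing }

  open CommutativeRing ring using
    (+-assoc; +-comm; +-identityˡ; +-identityʳ; -‿inverseˡ; -‿inverseʳ;
     *-assoc; *-comm; *-identityˡ; *-identityʳ; zeroˡ; zeroʳ; distribˡ; distribʳ)
  open import Algebra.Properties.Ring (CommutativeRing.ring ring)
    using (-0#≈0#; -‿involutive; -‿distribˡ-*; -1*x≈-x; -‿+-comm; -‿injective; +-cancelʳ;
           x∙y⁻¹≈ε⇒x≈y; +-inverseʳ-unique)
  open import Algebra.Properties.CommutativeSemigroup (CommutativeRing.+-commutativeSemigroup ring)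
    using () renaming (interchange to +-interchange)
  open import Algebra.Properties.CommutativeSemigroup (CommutativeRing.*-commutativeSemigroup ring)
    using () renaming (x∙yz≈y∙xz to *-left-comm)

  no-zero-divisors : ∀ {x y} → x * y ≡ 0# → x ≡ 0# ⊎ y ≡ 0#
  no-zero-divisors {x} {y} xy≡0 with x ≟ 0#
  ... | yes x≡0 = inj₁ x≡0
  ... | no x≢0 with inverse x x≢0
  ...   | x⁻¹ , xx⁻¹≡1 = inj₂ (begin
    y              ≡⟨ sym (*-identityˡ y) ⟩
    1# * y         ≡⟨ cong (_* y) (trans (sym xx⁻¹≡1) (*-comm x x⁻¹)) ⟩
    (x⁻¹ * x) * y  ≡⟨ *-assoc x⁻¹ x y ⟩
    x⁻¹ * (x * y)  ≡⟨ cong (x⁻¹ *_) xy≡0 ⟩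
    x⁻¹ * 0#       ≡⟨ zeroʳ x⁻¹ ⟩
    0#             ∎)
    where open ≡-Reasoning

  *-≢0 : ∀ {x y} → x ≢ 0# → y ≢ 0# → x * y ≢ 0#
  *-≢0 x≢0 y≢0 xy≡0 with no-zero-divisors xy≡0
  ... | inj₁ x≡0 = x≢0 x≡0
  ... | inj₂ y≡0 = y≢0 y≡0

  1≢0 : 1# ≢ 0#
  1≢0 1≡0 = 0≢1 (sym 1≡0)

  x-y≢0 : ∀ {x y} → x ≢ y → x + - y ≢ 0#
  x-y≢0 x≢y x-y≡0 = x≢y (x∙y⁻¹≈ε⇒x≈y _ _ x-y≡0)

  ==⇒≡ : ∀ {a b} → T (a == b) → a ≡ b
  ==⇒≡ {a} {b} _ with a ≟ b
  ... | yes a≡b = a≡b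

  ≡⇒== : ∀ {a b} → a ≡ b → T (a == b)
  ≡⇒== {a} {b} a≡b with a ≟ b
  ... | yes _ = _
  ... | no a≢b = a≢b a≡b

  ≢⇒not== : ∀ {a b} → a ≢ b → T (not (a == b))
  ≢⇒not== {a} {b} a≢b with a ≟ b
  ... | yes a≡b = a≢b a≡b
  ... | no _ = _

  -- Polynomials are coefficient lists with trailing zeros allowed, so the right notion of
  -- equality is coefficientwise: p ≋ q when all coefficients agree.
  coeff : Pol → ℕ → Carrier
  coeff []       _       = 0#
  coeff (x ∷ xs) zero    = x
  coeff (x ∷ xs) (suc k) = coeff xs k

  infix 4 _≋_
  record _≋_ (p q : Pol) : Set where
    constructor mk≋
    field at : ∀ k → coeff p k ≡ coeff q k
  open _≋_ public

  ≋-refl : ∀ {p} → p ≋ p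
  ≋-refl = mk≋ λ _ → refl

  ≋-sym : ∀ {p q} → p ≋ q → q ≋ p
  ≋-sym p≋q = mk≋ λ k → sym (at p≋q k)

  ≋-trans : ∀ {p q r} → p ≋ q → q ≋ r → p ≋ r
  ≋-trans p≋q q≋r = mk≋ λ k → trans (at p≋q k) (at q≋r k)

  ≋-setoid : Setoid 0ℓ 0ℓ
  ≋-setoid = record
    { Carrier = Pol ; _≈_ = _≋_
    ; isEquivalence = record { refl = ≋-refl ; sym = ≋-sym ; trans = ≋-trans } }

  ≡⇒≋ : ∀ {p q} → p ≡ q → p ≋ q
  ≡⇒≋ refl = ≋-refl

  ∷-cong : ∀ {x y xs ys} → x ≡ y → xs ≋ ys → x ∷ xs ≋ y ∷ ys
  ∷-cong x≡y xs≋ys = mk≋ λ { zero → x≡y ; (suc k) → at xs≋ys k }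

  ∷-inv : ∀ {x y xs ys} → x ∷ xs ≋ y ∷ ys → x ≡ y × xs ≋ ys
  ∷-inv e = at e zero , mk≋ λ k → at e (suc k)

  ∷≋0-inv : ∀ {x xs} → x ∷ xs ≋ [] → x ≡ 0# × xs ≋ []
  ∷≋0-inv e = at e zero , mk≋ λ k → at e (suc k)

  ∷≋0 : ∀ {x xs} → x ≡ 0# → xs ≋ [] → x ∷ xs ≋ []
  ∷≋0 x≡0 xs≋0 = mk≋ λ { zero → x≡0 ; (suc k) → at xs≋0 k }

  [0]≋0 : [ 0# ] ≋ []
  [0]≋0 = ∷≋0 refl ≋-refl

  shift : Pol → Pol
  shift p = 0# ∷ p

  coeff-add : ∀ p q k → coeff (addP p q) k ≡ coeff p k + coeff q k
  coeff-add []       q        k       = sym (+-identityˡ _)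
  coeff-add (x ∷ xs) []       k       = sym (+-identityʳ _)
  coeff-add (x ∷ xs) (y ∷ ys) zero    = refl
  coeff-add (x ∷ xs) (y ∷ ys) (suc k) = coeff-add xs ys k

  coeff-neg : ∀ p k → coeff (negP p) k ≡ - coeff p k
  coeff-neg []       k       = sym -0#≈0#
  coeff-neg (x ∷ xs) zero    = refl
  coeff-neg (x ∷ xs) (suc k) = coeff-neg xs k

  coeff-scal : ∀ a p k → coeff (scalP a p) k ≡ a * coeff p k
  coeff-scal a []       k       = sym (zeroʳ a)
  coeff-scal a (x ∷ xs) zero    = refl
  coeff-scal a (x ∷ xs) (suc k) = coeff-scal a xs k

  add-cong : ∀ {p p' q q'} → p ≋ p' → q ≋ q' → addP p q ≋ addP p' q'
  add-cong {p} {p'} {q} {q'} p≋p' q≋q' = mk≋ λ k →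
    trans (coeff-add p q k) (trans (cong₂ _+_ (at p≋p' k) (at q≋q' k)) (sym (coeff-add p' q' k)))

  addˡ-cong : ∀ p {q q'} → q ≋ q' → addP p q ≋ addP p q'
  addˡ-cong p = add-cong (≋-refl {p})

  scal-cong : ∀ {a b p q} → a ≡ b → p ≋ q → scalP a p ≋ scalP b q
  scal-cong {a} {b} {p} {q} a≡b p≋q = mk≋ λ k →
    trans (coeff-scal a p k) (trans (cong₂ _*_ a≡b (at p≋q k)) (sym (coeff-scal b q k)))

  add-comm : ∀ p q → addP p q ≋ addP q p
  add-comm p q = mk≋ λ k → trans (coeff-add p q k) (trans (+-comm _ _) (sym (coeff-add q p k)))

  add-assoc : ∀ p q r → addP (addP p q) r ≋ addP p (addP q r)
  add-assoc p q r = mk≋ λ k → begin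
    coeff (addP (addP p q) r) k          ≡⟨ coeff-add (addP p q) r k ⟩
    coeff (addP p q) k + coeff r k       ≡⟨ cong (_+ coeff r k) (coeff-add p q k) ⟩
    coeff p k + coeff q k + coeff r k    ≡⟨ +-assoc _ _ _ ⟩
    coeff p k + (coeff q k + coeff r k)  ≡⟨ cong (coeff p k +_) (sym (coeff-add q r k)) ⟩
    coeff p k + coeff (addP q r) k       ≡⟨ sym (coeff-add p (addP q r) k) ⟩
    coeff (addP p (addP q r)) k          ∎
    where open ≡-Reasoning

  add-identityʳ : ∀ p → addP p [] ≋ p
  add-identityʳ p = mk≋ λ k → trans (coeff-add p [] k) (+-identityʳ _)

  add-interchange : ∀ a b c d → addP (addP a b) (addP c d) ≋ addP (addP a c) (addP b d)
  add-interchange a b c d = mk≋ λ k → begin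
    coeff (addP (addP a b) (addP c d)) k                ≡⟨ coeff-add (addP a b) (addP c d) k ⟩
    coeff (addP a b) k + coeff (addP c d) k             ≡⟨ cong₂ _+_ (coeff-add a b k) (coeff-add c d k) ⟩
    (coeff a k + coeff b k) + (coeff c k + coeff d k)   ≡⟨ +-interchange _ _ _ _ ⟩
    (coeff a k + coeff c k) + (coeff b k + coeff d k)   ≡⟨ sym (cong₂ _+_ (coeff-add a c k) (coeff-add b d k)) ⟩
    coeff (addP a c) k + coeff (addP b d) k             ≡⟨ sym (coeff-add (addP a c) (addP b d) k) ⟩
    coeff (addP (addP a c) (addP b d)) k                ∎
    where open ≡-Reasoning

  add-left-comm : ∀ p q r → addP p (addP q r) ≋ addP q (addP p r)
  add-left-comm p q r =
    ≋-trans (≋-sym (add-assoc p q r)) (≋-trans (add-cong (add-comm p q) (≋-refl {r})) (add-assoc q p r))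

  add-neg : ∀ p → addP p (negP p) ≋ []
  add-neg p = mk≋ λ k → trans (coeff-add p (negP p) k) (trans (cong (coeff p k +_) (coeff-neg p k)) (-‿inverseʳ _))

  sub≋0⇒≋ : ∀ {p q} → addP p (negP q) ≋ [] → p ≋ q
  sub≋0⇒≋ {p} {q} e = mk≋ λ k → x∙y⁻¹≈ε⇒x≈y _ _
    (trans (cong (coeff p k +_) (sym (coeff-neg q k))) (trans (sym (coeff-add p (negP q) k)) (at e k)))

  neg≋scal : ∀ q → negP q ≋ scalP (- 1#) q
  neg≋scal q = mk≋ λ k → trans (coeff-neg q k) (trans (sym (-1*x≈-x _)) (sym (coeff-scal (- 1#) q k)))

  scal-distrib-add : ∀ a p q → scalP a (addP p q) ≋ addP (scalP a p) (scalP a q)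
  scal-distrib-add a p q = mk≋ λ k → begin
    coeff (scalP a (addP p q)) k                   ≡⟨ coeff-scal a (addP p q) k ⟩
    a * coeff (addP p q) k                         ≡⟨ cong (a *_) (coeff-add p q k) ⟩
    a * (coeff p k + coeff q k)                    ≡⟨ distribˡ a _ _ ⟩
    a * coeff p k + a * coeff q k                  ≡⟨ sym (cong₂ _+_ (coeff-scal a p k) (coeff-scal a q k)) ⟩
    coeff (scalP a p) k + coeff (scalP a q) k      ≡⟨ sym (coeff-add (scalP a p) (scalP a q) k) ⟩
    coeff (addP (scalP a p) (scalP a q)) k         ∎
    where open ≡-Reasoning

  scal-distrib-+ : ∀ a b p → scalP (a + b) p ≋ addP (scalP a p) (scalP b p)
  scal-distrib-+ a b p = mk≋ λ k → begin
    coeff (scalP (a + b) p) k                      ≡⟨ coeff-scal (a + b) p k ⟩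
    (a + b) * coeff p k                            ≡⟨ distribʳ _ a b ⟩
    a * coeff p k + b * coeff p k                  ≡⟨ sym (cong₂ _+_ (coeff-scal a p k) (coeff-scal b p k)) ⟩
    coeff (scalP a p) k + coeff (scalP b p) k      ≡⟨ sym (coeff-add (scalP a p) (scalP b p) k) ⟩
    coeff (addP (scalP a p) (scalP b p)) k         ∎
    where open ≡-Reasoning

  scal-scal : ∀ a b p → scalP a (scalP b p) ≋ scalP (a * b) p
  scal-scal a b p = mk≋ λ k →
    trans (coeff-scal a (scalP b p) k) (trans (cong (a *_) (coeff-scal b p k))
      (trans (sym (*-assoc a b _)) (sym (coeff-scal (a * b) p k))))

  scal-zero : ∀ p → scalP 0# p ≋ []
  scal-zero p = mk≋ λ k → trans (coeff-scal 0# p k) (zeroˡ _)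

  scal-one : ∀ p → scalP 1# p ≋ p
  scal-one p = mk≋ λ k → trans (coeff-scal 1# p k) (*-identityˡ _)

  scal-oneP : ∀ c → scalP c oneP ≋ [ c ]
  scal-oneP c = ∷-cong (*-identityʳ c) ≋-refl

  scal-cancel : ∀ {c p q} → c ≢ 0# → scalP c p ≋ scalP c q → p ≋ q
  scal-cancel {c} {p} {q} c≢0 e with inverse c c≢0
  ... | c⁻¹ , cc⁻¹≡1 = ≋-trans (≋-sym (undo p)) (≋-trans (scal-cong refl e) (undo q))
    where
    undo : ∀ r → scalP c⁻¹ (scalP c r) ≋ r
    undo r = ≋-trans (scal-scal c⁻¹ c r)
               (≋-trans (scal-cong (trans (*-comm c⁻¹ c) cc⁻¹≡1) (≋-refl {r})) (scal-one r))

  shift-cong : ∀ {p q} → p ≋ q → shift p ≋ shift q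
  shift-cong = ∷-cong refl

  shift-add : ∀ p q → shift (addP p q) ≋ addP (shift p) (shift q)
  shift-add p q = ∷-cong (sym (+-identityˡ 0#)) ≋-refl

  shift-scal : ∀ a p → shift (scalP a p) ≋ scalP a (shift p)
  shift-scal a p = ∷-cong (sym (zeroʳ a)) ≋-refl

  shift-zero : ∀ {p} → p ≋ [] → shift p ≋ []
  shift-zero = ∷≋0 refl

  ∷-split : ∀ x xs → x ∷ xs ≋ addP [ x ] (shift xs)
  ∷-split x xs = ∷-cong (sym (+-identityʳ x)) ≋-refl

  mul-zeroʳ : ∀ p → mulP p [] ≋ []
  mul-zeroʳ []       = ≋-refl
  mul-zeroʳ (x ∷ xs) = ∷≋0 refl (mul-zeroʳ xs)

  mul-zeroˡ : ∀ {p} q → p ≋ [] → mulP p q ≋ []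
  mul-zeroˡ {[]}     q _ = ≋-refl
  mul-zeroˡ {x ∷ xs} q p≋0 with ∷≋0-inv p≋0
  ... | x≡0 , xs≋0 =
    ≋-trans (add-cong (≋-trans (scal-cong x≡0 (≋-refl {q})) (scal-zero q)) (shift-zero (mul-zeroˡ q xs≋0)))
                             (add-identityʳ [])

  mul-congˡ : ∀ {p p'} q → p ≋ p' → mulP p q ≋ mulP p' q
  mul-congˡ {[]}     {[]}     q _ = ≋-refl
  mul-congˡ {[]}     {y ∷ ys} q e = ≋-sym (mul-zeroˡ q (≋-sym e))
  mul-congˡ {x ∷ xs} {[]}     q e = mul-zeroˡ q e
  mul-congˡ {x ∷ xs} {y ∷ ys} q e with ∷-inv e
  ... | x≡y , xs≋ys = add-cong (scal-cong x≡y (≋-refl {q})) (shift-cong (mul-congˡ q xs≋ys))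

  mul-congʳ : ∀ p {q q'} → q ≋ q' → mulP p q ≋ mulP p q'
  mul-congʳ []       _ = ≋-refl
  mul-congʳ (x ∷ xs) e = add-cong (scal-cong refl e) (shift-cong (mul-congʳ xs e))

  mul-cong : ∀ {p p' q q'} → p ≋ p' → q ≋ q' → mulP p q ≋ mulP p' q'
  mul-cong {p} {p'} {q} p≋p' q≋q' = ≋-trans (mul-congˡ q p≋p') (mul-congʳ p' q≋q')

  mul-shiftˡ : ∀ p q → mulP (shift p) q ≋ shift (mulP p q)
  mul-shiftˡ p q = add-cong (scal-zero q) (≋-refl {shift (mulP p q)})

  mul-shiftʳ : ∀ p q → mulP p (shift q) ≋ shift (mulP p q)
  mul-shiftʳ []       q = ≋-sym (shift-zero {[]} ≋-refl)
  mul-shiftʳ (x ∷ xs) q = ∷-cong (trans (+-identityʳ _) (zeroʳ x)) (addˡ-cong (scalP x q) (mul-shiftʳ xs q))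

  mul-constʳ : ∀ p x → mulP p [ x ] ≋ scalP x p
  mul-constʳ []       x = ≋-refl
  mul-constʳ (y ∷ ys) x = ∷-cong (trans (+-identityʳ _) (*-comm y x)) (mul-constʳ ys x)

  mul-distribˡ : ∀ p q r → mulP p (addP q r) ≋ addP (mulP p q) (mulP p r)
  mul-distribˡ []       q r = ≋-refl
  mul-distribˡ (x ∷ xs) q r = ≋-trans
    (add-cong (scal-distrib-add x q r) (≋-trans (shift-cong (mul-distribˡ xs q r)) (shift-add (mulP xs q) (mulP xs r))))
    (add-interchange (scalP x q) (scalP x r) (shift (mulP xs q)) (shift (mulP xs r)))

  mul-distribʳ : ∀ p q r → mulP (addP p q) r ≋ addP (mulP p r) (mulP q r)
  mul-distribʳ []       q        r = ≋-refl
  mul-distribʳ (x ∷ xs) []       r = ≋-sym (add-identityʳ _)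
  mul-distribʳ (x ∷ xs) (y ∷ ys) r = ≋-trans
    (add-cong (scal-distrib-+ x y r) (≋-trans (shift-cong (mul-distribʳ xs ys r)) (shift-add (mulP xs r) (mulP ys r))))
    (add-interchange (scalP x r) (scalP y r) (shift (mulP xs r)) (shift (mulP ys r)))

  mul-scalˡ : ∀ a p q → mulP (scalP a p) q ≋ scalP a (mulP p q)
  mul-scalˡ a []       q = ≋-refl
  mul-scalˡ a (x ∷ xs) q = ≋-trans
    (add-cong (≋-sym (scal-scal a x q)) (≋-trans (shift-cong (mul-scalˡ a xs q)) (shift-scal a _)))
    (≋-sym (scal-distrib-add a (scalP x q) (shift (mulP xs q))))

  mul-scalʳ : ∀ a p q → mulP p (scalP a q) ≋ scalP a (mulP p q)
  mul-scalʳ a []       q = ≋-refl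
  mul-scalʳ a (x ∷ xs) q = ≋-trans
    (add-cong (≋-trans (scal-scal x a q) (≋-trans (scal-cong (*-comm x a) (≋-refl {q})) (≋-sym (scal-scal a x q))))
              (≋-trans (shift-cong (mul-scalʳ a xs q)) (shift-scal a _)))
    (≋-sym (scal-distrib-add a (scalP x q) (shift (mulP xs q))))

  mul-comm : ∀ p q → mulP p q ≋ mulP q p
  mul-comm []       q = ≋-sym (mul-zeroʳ q)
  mul-comm (x ∷ xs) q = ≋-sym (begin
    mulP q (x ∷ xs)                          ≈⟨ mul-congʳ q (∷-split x xs) ⟩
    mulP q (addP [ x ] (shift xs))           ≈⟨ mul-distribˡ q [ x ] (shift xs) ⟩
    addP (mulP q [ x ]) (mulP q (shift xs))  ≈⟨ add-cong (mul-constʳ q x)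
                                                  (≋-trans (mul-shiftʳ q xs) (shift-cong (mul-comm q xs))) ⟩
    addP (scalP x q) (shift (mulP xs q))     ∎)
    where open import Relation.Binary.Reasoning.Setoid ≋-setoid

  mul-assoc : ∀ p q r → mulP (mulP p q) r ≋ mulP p (mulP q r)
  mul-assoc []       q r = ≋-refl
  mul-assoc (x ∷ xs) q r = ≋-trans (mul-distribʳ (scalP x q) (shift (mulP xs q)) r)
    (add-cong (mul-scalˡ x q r) (≋-trans (mul-shiftˡ (mulP xs q) r) (shift-cong (mul-assoc xs q r))))

  mul-identityˡ : ∀ p → mulP oneP p ≋ p
  mul-identityˡ p = ≋-trans (add-cong (scal-one p) [0]≋0) (add-identityʳ p)

  mul-identityʳ : ∀ p → mulP p oneP ≋ p
  mul-identityʳ p = ≋-trans (mul-comm p oneP) (mul-identityˡ p)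

  mul-neg : ∀ p q → mulP p (negP q) ≋ negP (mulP p q)
  mul-neg p q = ≋-trans (mul-congʳ p (neg≋scal q)) (≋-trans (mul-scalʳ (- 1#) p q) (≋-sym (neg≋scal (mulP p q))))

  mul-left-comm : ∀ p q r → mulP p (mulP q r) ≋ mulP q (mulP p r)
  mul-left-comm p q r =
    ≋-trans (≋-sym (mul-assoc p q r)) (≋-trans (mul-congˡ r (mul-comm p q)) (mul-assoc q p r))

  eval : Pol → Carrier → Carrier
  eval []       a = 0#
  eval (x ∷ xs) a = x + a * eval xs a

  eval-zero : ∀ {p} a → p ≋ [] → eval p a ≡ 0#
  eval-zero {[]}     a _   = refl
  eval-zero {x ∷ xs} a p≋0 with ∷≋0-inv p≋0
  ... | x≡0 , xs≋0 = trans (cong₂ (λ u v → u + a * v) x≡0 (eval-zero a xs≋0)) (trans (+-identityˡ _) (zeroʳ a))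

  eval-cong : ∀ {p q} a → p ≋ q → eval p a ≡ eval q a
  eval-cong {[]}     {[]}     a _ = refl
  eval-cong {[]}     {y ∷ ys} a e = sym (eval-zero a (≋-sym e))
  eval-cong {x ∷ xs} {[]}     a e = eval-zero a e
  eval-cong {x ∷ xs} {y ∷ ys} a e with ∷-inv e
  ... | x≡y , xs≋ys = cong₂ (λ u v → u + a * v) x≡y (eval-cong a xs≋ys)

  eval-add : ∀ p q a → eval (addP p q) a ≡ eval p a + eval q a
  eval-add []       q        a = sym (+-identityˡ _)
  eval-add (x ∷ xs) []       a = sym (+-identityʳ _)
  eval-add (x ∷ xs) (y ∷ ys) a = begin
    (x + y) + a * eval (addP xs ys) a            ≡⟨ cong (λ z → (x + y) + a * z) (eval-add xs ys a) ⟩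
    (x + y) + a * (eval xs a + eval ys a)        ≡⟨ cong ((x + y) +_) (distribˡ a _ _) ⟩
    (x + y) + (a * eval xs a + a * eval ys a)    ≡⟨ +-interchange x y _ _ ⟩
    (x + a * eval xs a) + (y + a * eval ys a)    ∎
    where open ≡-Reasoning

  eval-scal : ∀ c p a → eval (scalP c p) a ≡ c * eval p a
  eval-scal c []       a = sym (zeroʳ c)
  eval-scal c (x ∷ xs) a = begin
    c * x + a * eval (scalP c xs) a   ≡⟨ cong (λ z → c * x + a * z) (eval-scal c xs a) ⟩
    c * x + a * (c * eval xs a)       ≡⟨ cong (c * x +_) (*-left-comm a c _) ⟩
    c * x + c * (a * eval xs a)       ≡⟨ sym (distribˡ c x _) ⟩
    c * (x + a * eval xs a)           ∎
    where open ≡-Reasoning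

  eval-mul : ∀ p q a → eval (mulP p q) a ≡ eval p a * eval q a
  eval-mul []       q a = sym (zeroˡ _)
  eval-mul (x ∷ xs) q a = begin
    eval (addP (scalP x q) (shift (mulP xs q))) a          ≡⟨ eval-add (scalP x q) (shift (mulP xs q)) a ⟩
    eval (scalP x q) a + (0# + a * eval (mulP xs q) a)     ≡⟨ cong₂ _+_ (eval-scal x q a) (+-identityˡ _) ⟩
    x * eval q a + a * eval (mulP xs q) a                  ≡⟨ cong (λ z → x * eval q a + a * z) (eval-mul xs q a) ⟩
    x * eval q a + a * (eval xs a * eval q a)              ≡⟨ cong (x * eval q a +_) (sym (*-assoc a _ _)) ⟩
    x * eval q a + (a * eval xs a) * eval q a              ≡⟨ sym (distribʳ _ x _) ⟩
    (x + a * eval xs a) * eval q a                         ∎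
    where open ≡-Reasoning

  linear : Carrier → Pol
  linear a = (- a) ∷ 1# ∷ []

  eval-linear : ∀ b a → eval (linear b) a ≡ a + - b
  eval-linear b a = begin
    - b + a * (1# + a * 0#)  ≡⟨ cong (λ z → - b + a * (1# + z)) (zeroʳ a) ⟩
    - b + a * (1# + 0#)      ≡⟨ cong (λ z → - b + a * z) (+-identityʳ 1#) ⟩
    - b + a * 1#             ≡⟨ cong (- b +_) (*-identityʳ a) ⟩
    - b + a                  ≡⟨ +-comm _ _ ⟩
    a + - b                  ∎
    where open ≡-Reasoning

  eval-linear-root : ∀ a → eval (linear a) a ≡ 0#
  eval-linear-root a = trans (eval-linear a a) (-‿inverseʳ a)

  eval-linear-multiple : ∀ a q → eval (mulP (linear a) q) a ≡ 0#
  eval-linear-multiple a q = trans (eval-mul (linear a) q a) (trans (cong (_* eval q a) (eval-linear-root a)) (zeroˡ _))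

  mul-linear : ∀ a q → mulP (linear a) q ≋ addP (scalP (- a) q) (shift q)
  mul-linear a q = addˡ-cong (scalP (- a) q) (shift-cong (mul-identityˡ q))

  -- Synthetic division by T - a: the quotient has coefficients the partial Horner values.
  divLinear : Carrier → Pol → Pol
  divLinear a []       = []
  divLinear a (x ∷ xs) = eval xs a ∷ divLinear a xs

  division-by-linear : ∀ a p → p ≋ addP (mulP (linear a) (divLinear a p)) [ eval p a ]
  division-by-linear a [] = ≋-sym (add-cong (mul-zeroʳ (linear a)) [0]≋0)
  division-by-linear a (x ∷ xs) = ≋-trans (∷-cong (sym constant) (division-by-linear a xs)) (≋-sym expand)
    where
    r = eval xs a
    Q = divLinear a xs
    constant : (- a) * r + (x + a * r) ≡ x
    constant = begin
      (- a) * r + (x + a * r)    ≡⟨ cong₂ _+_ (sym (-‿distribˡ-* a r)) (+-comm x _) ⟩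
      - (a * r) + (a * r + x)    ≡⟨ sym (+-assoc _ _ _) ⟩
      (- (a * r) + a * r) + x    ≡⟨ cong (_+ x) (-‿inverseˡ _) ⟩
      0# + x                     ≡⟨ +-identityˡ x ⟩
      x                          ∎
      where open ≡-Reasoning
    expand : addP (mulP (linear a) (r ∷ Q)) [ x + a * r ]
           ≋ ((- a) * r + (x + a * r)) ∷ addP (mulP (linear a) Q) [ r ]
    expand = begin
      addP (mulP (linear a) (r ∷ Q)) [ x + a * r ]
        ≈⟨ add-cong (mul-linear a (r ∷ Q)) (≋-refl {[ x + a * r ]}) ⟩
      ((- a) * r + 0# + (x + a * r)) ∷ addP (addP (scalP (- a) Q) (r ∷ Q)) []
        ≈⟨ ∷-cong (cong (_+ (x + a * r)) (+-identityʳ _)) (add-identityʳ _) ⟩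
      ((- a) * r + (x + a * r)) ∷ addP (scalP (- a) Q) (r ∷ Q)
        ≈⟨ ∷-cong refl (addˡ-cong (scalP (- a) Q) (∷-split r Q)) ⟩
      ((- a) * r + (x + a * r)) ∷ addP (scalP (- a) Q) (addP [ r ] (shift Q))
        ≈⟨ ∷-cong refl (add-left-comm (scalP (- a) Q) [ r ] (shift Q)) ⟩
      ((- a) * r + (x + a * r)) ∷ addP [ r ] (addP (scalP (- a) Q) (shift Q))
        ≈⟨ ∷-cong refl (≋-trans (add-comm [ r ] (addP (scalP (- a) Q) (shift Q)))
                                (add-cong (≋-sym (mul-linear a Q)) (≋-refl {[ r ]}))) ⟩
      ((- a) * r + (x + a * r)) ∷ addP (mulP (linear a) Q) [ r ]
        ∎
      where open import Relation.Binary.Reasoning.Setoid ≋-setoid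

  root⇒factor : ∀ a p → eval p a ≡ 0# → p ≋ mulP (linear a) (divLinear a p)
  root⇒factor a p p[a]≡0 = ≋-trans (division-by-linear a p)
    (≋-trans (addˡ-cong (mulP (linear a) (divLinear a p)) (≋-trans (≡⇒≋ (cong [_] p[a]≡0)) [0]≋0))
             (add-identityʳ _))

  -- (T - a)·Z ≋ 0 gives the recursion zₖ = a·zₖ₊₁, which forces Z ≋ 0.
  linear-zero-divisor : ∀ a Z → mulP (linear a) Z ≋ [] → Z ≋ []
  linear-zero-divisor a Z e = descend Z recursion
    where
    descend : ∀ Z → (∀ k → coeff Z k ≡ a * coeff Z (suc k)) → Z ≋ []
    descend []      _ = ≋-refl
    descend (z ∷ Z) h = ∷≋0 (trans (h 0) (trans (cong (a *_) (at IH 0)) (zeroʳ a))) IH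
      where IH = descend Z (λ k → h (suc k))
    recursion : ∀ k → coeff Z k ≡ a * coeff Z (suc k)
    recursion k = begin
      coeff Z k                    ≡⟨ +-inverseʳ-unique _ _ coefficient ⟩
      - ((- a) * coeff Z (suc k))  ≡⟨ cong -_ (sym (-‿distribˡ-* a _)) ⟩
      - (- (a * coeff Z (suc k)))  ≡⟨ -‿involutive _ ⟩
      a * coeff Z (suc k)          ∎
      where
      open ≡-Reasoning
      coefficient : (- a) * coeff Z (suc k) + coeff Z k ≡ 0#
      coefficient = trans (cong (_+ coeff Z k) (sym (coeff-scal (- a) Z (suc k))))
        (trans (sym (coeff-add (scalP (- a) Z) (shift Z) (suc k))) (trans (sym (at (mul-linear a Z) (suc k))) (at e (suc k))))

  linear-cancel : ∀ a {X Y} → mulP (linear a) X ≋ mulP (linear a) Y → X ≋ Y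
  linear-cancel a {X} {Y} e = sub≋0⇒≋ (linear-zero-divisor a (addP X (negP Y))
    (≋-trans (mul-distribˡ (linear a) X (negP Y))
    (≋-trans (add-cong e (mul-neg (linear a) Y)) (add-neg (mulP (linear a) Y)))))

  VanishAbove : Pol → ℕ → Set
  VanishAbove p d = ∀ j → d < j → coeff p j ≡ 0#

  record HasDeg (p : Pol) (d : ℕ) : Set where
    constructor mkDeg
    field
      lead≢0 : coeff p d ≢ 0#
      vanish : VanishAbove p d

  mul-top : ∀ p q m k → VanishAbove p m → VanishAbove q k →
            VanishAbove (mulP p q) (m ℕ.+ k) × coeff (mulP p q) (m ℕ.+ k) ≡ coeff p m * coeff q k
  mul-top []       q m       k _    _    = (λ _ _ → refl) , sym (zeroˡ _)
  mul-top (x ∷ xs) q zero    k p-van q-van = vanish , top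
    where
    p≋x : mulP (x ∷ xs) q ≋ scalP x q
    p≋x = ≋-trans (addˡ-cong (scalP x q) (shift-zero (mul-zeroˡ {xs} q (mk≋ λ j → p-van (suc j) (s≤s z≤n)))))
                  (add-identityʳ (scalP x q))
    vanish : VanishAbove (mulP (x ∷ xs) q) k
    vanish j k<j = trans (at p≋x j) (trans (coeff-scal x q j) (trans (cong (x *_) (q-van j k<j)) (zeroʳ x)))
    top : coeff (mulP (x ∷ xs) q) k ≡ x * coeff q k
    top = trans (at p≋x k) (coeff-scal x q k)
  mul-top (x ∷ xs) q (suc m) k p-van q-van = vanish , top
    where
    IH = mul-top xs q m k (λ j m<j → p-van (suc j) (s≤s m<j)) q-van
    -- coefficient j+1 of x·q + T·(xs·q) is x·q_{j+1} + (xs·q)_j, and q_{j+1} = 0 above m + k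
    step : ∀ j → m ℕ.+ k ≤ j → coeff (mulP (x ∷ xs) q) (suc j) ≡ coeff (mulP xs q) j
    step j m+k≤j = trans (coeff-add (scalP x q) (shift (mulP xs q)) (suc j))
      (trans (cong (_+ coeff (mulP xs q) j) (trans (coeff-scal x q (suc j))
               (trans (cong (x *_) (q-van (suc j) (s≤s (ℕP.≤-trans (ℕP.m≤n+m k m) m+k≤j)))) (zeroʳ x))))
             (+-identityˡ _))
    vanish : VanishAbove (mulP (x ∷ xs) q) (suc (m ℕ.+ k))
    vanish (suc j) (s≤s m+k<j) = trans (step j (ℕP.<⇒≤ m+k<j)) (proj₁ IH j m+k<j)
    top : coeff (mulP (x ∷ xs) q) (suc (m ℕ.+ k)) ≡ coeff xs m * coeff q k
    top = trans (step (m ℕ.+ k) ℕP.≤-refl) (proj₂ IH)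

  deg-mul : ∀ {p q m k} → HasDeg p m → HasDeg q k → HasDeg (mulP p q) (m ℕ.+ k)
  deg-mul {p} {q} {m} {k} (mkDeg pₘ≢0 p-van) (mkDeg qₖ≢0 q-van) with mul-top p q m k p-van q-van
  ... | vanish , top = mkDeg (λ e → *-≢0 pₘ≢0 qₖ≢0 (trans (sym top) e)) vanish

  deg-cong : ∀ {p q d} → p ≋ q → HasDeg p d → HasDeg q d
  deg-cong e (mkDeg lead van) = mkDeg (λ z → lead (trans (at e _) z)) (λ j d<j → trans (sym (at e j)) (van j d<j))

  deg-unique : ∀ {p d d'} → HasDeg p d → HasDeg p d' → d ≡ d'
  deg-unique {p} {d} {d'} (mkDeg lead van) (mkDeg lead' van') with ℕP.<-cmp d d'
  ... | tri< d<d' _ _ = ⊥-elim (lead' (van d' d<d'))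
  ... | tri≈ _ d≡d' _ = d≡d'
  ... | tri> _ _ d'<d = ⊥-elim (lead (van' d d'<d))

  deg-nonzero : ∀ {p d} → HasDeg p d → ¬ (p ≋ [])
  deg-nonzero (mkDeg lead _) p≋0 = lead (at p≋0 _)

  deg-const : ∀ {x} → x ≢ 0# → HasDeg [ x ] 0
  deg-const x≢0 = mkDeg x≢0 λ { (suc j) _ → refl }

  ≋0? : ∀ p → Dec (p ≋ [])
  ≋0? []       = yes ≋-refl
  ≋0? (y ∷ ys) with y ≟ 0# | ≋0? ys
  ... | yes y≡0 | yes ys≋0 = yes (∷≋0 y≡0 ys≋0)
  ... | no y≢0  | _        = no λ e → y≢0 (proj₁ (∷≋0-inv e))
  ... | _       | no ys≉0  = no λ e → ys≉0 (proj₂ (∷≋0-inv e))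

  deg-exists : ∀ p → ¬ (p ≋ []) → ∃ λ d → HasDeg p d
  deg-exists []       p≉0 = ⊥-elim (p≉0 ≋-refl)
  deg-exists (x ∷ xs) p≉0 with ≋0? xs
  ... | yes xs≋0 = 0 , mkDeg (λ x≡0 → p≉0 (∷≋0 x≡0 xs≋0)) λ { (suc j) _ → at xs≋0 j }
  ... | no xs≉0 with deg-exists xs xs≉0
  ...   | d , mkDeg lead van = suc d , mkDeg lead λ { (suc j) (s≤s d<j) → van j d<j }

  data Normal : Pol → Set where
    normal[] : Normal []
    normal[_] : ∀ {x} → x ≢ 0# → Normal [ x ]
    normal∷ : ∀ {x y ys} → Normal (y ∷ ys) → Normal (x ∷ y ∷ ys)

  normal-deg : ∀ {x xs} → Normal (x ∷ xs) → HasDeg (x ∷ xs) (length xs)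
  normal-deg normal[ x≢0 ] = deg-const x≢0
  normal-deg (normal∷ nf) with normal-deg nf
  ... | mkDeg lead van = mkDeg lead λ { (suc j) (s≤s d<j) → van j d<j }

  normal-nonzero : ∀ {x xs} → Normal (x ∷ xs) → ¬ (x ∷ xs ≋ [])
  normal-nonzero {x} {xs} nf = deg-nonzero {x ∷ xs} (normal-deg nf)

  normal-≋⇒≡ : ∀ {p q} → Normal p → Normal q → p ≋ q → p ≡ q
  normal-≋⇒≡ normal[]       normal[]        _ = refl
  normal-≋⇒≡ normal[]       nf@(normal[ _ ]) e = ⊥-elim (normal-nonzero nf (≋-sym e))
  normal-≋⇒≡ normal[]       nf@(normal∷ _)   e = ⊥-elim (normal-nonzero nf (≋-sym e))
  normal-≋⇒≡ nf@(normal[ _ ]) normal[]      e = ⊥-elim (normal-nonzero nf e)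
  normal-≋⇒≡ nf@(normal∷ _)   normal[]      e = ⊥-elim (normal-nonzero nf e)
  normal-≋⇒≡ normal[ _ ]    normal[ _ ]     e = cong [_] (at e 0)
  normal-≋⇒≡ normal[ _ ]    (normal∷ nf)    e = ⊥-elim (normal-nonzero nf (≋-sym (proj₂ (∷-inv e))))
  normal-≋⇒≡ (normal∷ nf)   normal[ _ ]     e = ⊥-elim (normal-nonzero nf (proj₂ (∷-inv e)))
  normal-≋⇒≡ (normal∷ nf)   (normal∷ nf')   e =
    cong₂ _∷_ (proj₁ (∷-inv e)) (normal-≋⇒≡ nf nf' (proj₂ (∷-inv e)))

  norm-≋ : ∀ p → norm p ≋ p
  norm-≋ []       = ≋-refl
  norm-≋ (x ∷ xs) with norm xs | norm-≋ xs
  ... | y ∷ ys | e = ∷-cong refl e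
  ... | []     | e with x ≟ 0#
  ...   | yes x≡0 = ≋-sym (∷≋0 x≡0 (≋-sym e))
  ...   | no _    = ∷-cong refl e

  norm-normal : ∀ p → Normal (norm p)
  norm-normal []       = normal[]
  norm-normal (x ∷ xs) with norm xs | norm-normal xs
  ... | y ∷ ys | nf = normal∷ nf
  ... | []     | _ with x ≟ 0#
  ...   | yes _   = normal[]
  ...   | no x≢0  = normal[ x≢0 ]

  normal⇒norm≡ : ∀ {p} → Normal p → norm p ≡ p
  normal⇒norm≡ {p} nf = normal-≋⇒≡ (norm-normal p) nf (norm-≋ p)

  norm-cong : ∀ {p q} → p ≋ q → norm p ≡ norm q
  norm-cong {p} {q} e =
    normal-≋⇒≡ (norm-normal p) (norm-normal q) (≋-trans (norm-≋ p) (≋-trans e (≋-sym (norm-≋ q))))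

  length-norm : ∀ {p d} → HasDeg p d → length (norm p) ≡ suc d
  length-norm {p} {d} hd with norm p | norm-normal p | norm-≋ p
  ... | []     | _  | e = ⊥-elim (deg-nonzero {p} hd (≋-sym e))
  ... | x ∷ xs | nf | e = cong suc (deg-unique {x ∷ xs} (normal-deg nf) (deg-cong {p} (≋-sym e) hd))

  deg≡ : ∀ {p d} → HasDeg p d → deg p ≡ d
  deg≡ {p} hd = cong (_∸ 1) (length-norm {p} hd)

  isZeroP-sound : ∀ p → T (isZeroP p) → p ≋ []
  isZeroP-sound []       _ = ≋-refl
  isZeroP-sound (x ∷ xs) t with Equivalence.to T-∧ t
  ... | x≟0 , xs≟0 = ∷≋0 (==⇒≡ x≟0) (isZeroP-sound xs xs≟0)

  isZeroP-complete : ∀ p → p ≋ [] → T (isZeroP p)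
  isZeroP-complete []       _   = _
  isZeroP-complete (x ∷ xs) p≋0 with ∷≋0-inv p≋0
  ... | x≡0 , xs≋0 = Equivalence.from T-∧ (≡⇒== x≡0 , isZeroP-complete xs xs≋0)

  eqP-sound : ∀ p q → T (eqP p q) → p ≋ q
  eqP-sound p q t = sub≋0⇒≋ (isZeroP-sound _ t)

  eqP-complete : ∀ p q → p ≋ q → T (eqP p q)
  eqP-complete p q p≋q = isZeroP-complete _ (≋-trans (add-cong p≋q (≋-refl {negP q})) (add-neg q))

  vecs-complete : ∀ k xs → length xs ≡ k → xs ∈ vecs k
  vecs-complete zero    []       refl = here refl
  vecs-complete (suc k) (x ∷ xs) refl = ∈-concatMap⁺ (λ a → map (a ∷_) (vecs k))
    (Any.map (λ { refl → ∈-map⁺ (x ∷_) (vecs-complete k xs refl) }) (elems-complete x))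

  vecs-length : ∀ k {xs} → xs ∈ vecs k → length xs ≡ k
  vecs-length zero    (here refl) = refl
  vecs-length (suc k) xs∈ with find (∈-concatMap⁻ (λ a → map (a ∷_) (vecs k)) {xs = elems} xs∈)
  ... | a , _ , xs∈′ with ∈-map⁻ (a ∷_) xs∈′
  ...   | ys , ys∈ , refl = cong suc (vecs-length k ys∈)

  vecs-unique : ∀ k → Unique (vecs k)
  vecs-unique zero    = [] ∷ []
  vecs-unique (suc k) = Unique.concat⁺
    (All.map⁺ (All.tabulate λ _ → Unique.map⁺ List.∷-injectiveʳ (vecs-unique k)))
    (AllPairs.map⁺ (AllPairs.map (λ a≢b {v} (v∈₁ , v∈₂) → a≢b (same-head v∈₁ v∈₂)) elems-unique))
    where
    same-head : ∀ {a b v} → v ∈ map (a ∷_) (vecs k) → v ∈ map (b ∷_) (vecs k) → a ≡ b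
    same-head v∈₁ v∈₂ with ∈-map⁻ _ v∈₁ | ∈-map⁻ _ v∈₂
    ... | _ , _ , refl | _ , _ , e = List.∷-injectiveˡ e

  snoc-coeff : ∀ ys z → coeff (ys ++ [ z ]) (length ys) ≡ z
  snoc-coeff []       z = refl
  snoc-coeff (y ∷ ys) z = snoc-coeff ys z

  snoc-vanish : ∀ ys z → VanishAbove (ys ++ [ z ]) (length ys)
  snoc-vanish []       z (suc j) _          = refl
  snoc-vanish (y ∷ ys) z (suc j) (s≤s d<j) = snoc-vanish ys z j d<j

  snoc-normal : ∀ ys {z} → z ≢ 0# → Normal (ys ++ [ z ])
  snoc-normal []           z≢0 = normal[ z≢0 ]
  snoc-normal (y ∷ [])     z≢0 = normal∷ normal[ z≢0 ]
  snoc-normal (y ∷ y' ∷ ys) z≢0 = normal∷ (snoc-normal (y' ∷ ys) z≢0)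

  unsnoc : ∀ x xs → ∃₂ λ (ys : Pol) (z : Carrier) → x ∷ xs ≡ ys ++ [ z ] × length ys ≡ length xs
  unsnoc x []       = [] , x , refl , refl
  unsnoc x (y ∷ ys) with unsnoc y ys
  ... | zs , z , e , len = x ∷ zs , z , cong (x ∷_) e , cong suc len

  normal-snoc : ∀ {P d} → Normal P → HasDeg P d → ∃₂ λ ys z → P ≡ ys ++ [ z ] × length ys ≡ d × z ≢ 0#
  normal-snoc {[]}     _  hd = ⊥-elim (deg-nonzero {[]} hd ≋-refl)
  normal-snoc {x ∷ xs} nf hd with unsnoc x xs
  ... | ys , z , e , len = ys , z , e , len≡d , z≢0
    where
    len≡d : length ys ≡ _
    len≡d = trans len (deg-unique {x ∷ xs} (normal-deg nf) hd)
    z≢0 : z ≢ 0#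
    z≢0 z≡0 = HasDeg.lead≢0 (normal-deg nf)
      (trans (cong (coeff (x ∷ xs)) (sym len)) (trans (cong (λ P → coeff P (length ys)) e) (trans (snoc-coeff ys z) z≡0)))

  record Monic (p : Pol) (d : ℕ) : Set where
    constructor mkMonic
    field
      lead≡1 : coeff p d ≡ 1#
      vanish : VanishAbove p d

  monic-deg : ∀ {p d} → Monic p d → HasDeg p d
  monic-deg (mkMonic lead≡1 van) = mkDeg (λ lead≡0 → 1≢0 (trans (sym lead≡1) lead≡0)) van

  monic-mul : ∀ {p q m k} → Monic p m → Monic q k → Monic (mulP p q) (m ℕ.+ k)
  monic-mul {p} {q} {m} {k} (mkMonic pₘ≡1 p-van) (mkMonic qₖ≡1 q-van) with mul-top p q m k p-van q-van
  ... | vanish , top = mkMonic (trans top (trans (cong₂ _*_ pₘ≡1 qₖ≡1) (*-identityˡ 1#))) vanish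

  monic-cong : ∀ {p q d} → p ≋ q → Monic p d → Monic q d
  monic-cong e (mkMonic lead van) = mkMonic (trans (sym (at e _)) lead) λ j d<j → trans (sym (at e j)) (van j d<j)

  monicOfDeg-intro : ∀ ys → ys ++ [ 1# ] ∈ monicOfDeg (length ys)
  monicOfDeg-intro ys = ∈-map⁺ (_++ [ 1# ]) (vecs-complete (length ys) ys refl)

  monicOfDeg-elim : ∀ {d D} → D ∈ monicOfDeg d → ∃ λ (ys : Pol) → length ys ≡ d × D ≡ ys ++ [ 1# ]
  monicOfDeg-elim {d} D∈ with ∈-map⁻ (_++ [ 1# ]) D∈
  ... | ys , ys∈ , e = ys , vecs-length d ys∈ , e

  monicOfDeg-monic : ∀ {d D} → D ∈ monicOfDeg d → Normal D × Monic D d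
  monicOfDeg-monic {d} D∈ with monicOfDeg-elim {d} D∈
  ... | ys , refl , refl = snoc-normal ys 1≢0 , mkMonic (snoc-coeff ys 1#) (snoc-vanish ys 1#)

  monic⇒∈monicOfDeg : ∀ {P d} → Normal P → Monic P d → P ∈ monicOfDeg d
  monic⇒∈monicOfDeg {P} {d} nf mon with normal-snoc nf (monic-deg mon)
  ... | ys , z , refl , refl , _ = subst (λ w → ys ++ [ w ] ∈ monicOfDeg (length ys)) z≡1 (monicOfDeg-intro ys)
    where
    z≡1 : 1# ≡ z
    z≡1 = trans (sym (Monic.lead≡1 mon)) (snoc-coeff ys z)

  monicOfDeg-unique : ∀ d → Unique (monicOfDeg d)
  monicOfDeg-unique d = Unique.map⁺ (λ {xs} {ys} e → proj₁ (List.∷ʳ-injective xs ys e)) (vecs-unique d)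

  candidates-unique : ∀ {ds} → Unique ds → Unique (concatMap monicOfDeg ds)
  candidates-unique u = Unique.concat⁺ (All.map⁺ (All.tabulate λ {d} _ → monicOfDeg-unique d))
    (AllPairs.map⁺ (AllPairs.map (λ d≢d' {D} (D∈₁ , D∈₂) → d≢d' (same-degree D∈₁ D∈₂)) u))
    where
    same-degree : ∀ {d d' D} → D ∈ monicOfDeg d → D ∈ monicOfDeg d' → d ≡ d'
    same-degree D∈ D∈′ =
      deg-unique (monic-deg (proj₂ (monicOfDeg-monic D∈))) (monic-deg (proj₂ (monicOfDeg-monic D∈′)))

  -- divides D F searches all cofactors with length(norm F) - length(norm D) + 1 coefficients;
  -- for D of degree d and F of degree f this is exactly the length of a normal cofactor.
  divides-sound : ∀ D F → T (divides D F) → ∃ λ H → mulP D H ≋ F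
  divides-sound D F t with find (Any.any⁻ _ (vecs (suc (length (norm F) ∸ length (norm D)))) t)
  ... | H , _ , DH≟F = H , eqP-sound _ _ DH≟F

  divides-complete : ∀ {D F d f} H → HasDeg D d → HasDeg F f → mulP D H ≋ F → T (divides D F)
  divides-complete {D} {F} {d} {f} H hD hF DH≋F =
    Any.any⁺ _ (Any.map (λ { refl → eqP-complete _ _ (≋-trans (mul-congʳ D (norm-≋ H)) DH≋F) })
                        (subst (λ k → norm H ∈ vecs k) (sym search-length) (vecs-complete _ (norm H) refl)))
    where
    H≉0 : ¬ (H ≋ [])
    H≉0 H≋0 = deg-nonzero hF (≋-trans (≋-sym DH≋F) (≋-trans (mul-congʳ D H≋0) (mul-zeroʳ D)))
    h = proj₁ (deg-exists H H≉0)
    hH = proj₂ (deg-exists H H≉0)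
    d+h≡f : d ℕ.+ h ≡ f
    d+h≡f = deg-unique (deg-cong DH≋F (deg-mul hD hH)) hF
    search-length : suc (length (norm F) ∸ length (norm D)) ≡ length (norm H)
    search-length = begin
      suc (length (norm F) ∸ length (norm D))  ≡⟨ cong₂ (λ u v → suc (u ∸ v)) (length-norm hF) (length-norm hD) ⟩
      suc (f ∸ d)                              ≡⟨ cong (λ z → suc (z ∸ d)) (sym d+h≡f) ⟩
      suc (d ℕ.+ h ∸ d)                        ≡⟨ cong suc (ℕP.m+n∸m≡n d h) ⟩
      suc h                                    ≡⟨ sym (length-norm hH) ⟩
      length (norm H)                          ∎
      where open ≡-Reasoning

  linProd : List Carrier → Pol
  linProd []      = oneP
  linProd (a ∷ S) = mulP (linear a) (linProd S)

  monic-linear : ∀ a → Monic (linear a) 1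
  monic-linear a = mkMonic refl λ { (suc (suc j)) _ → refl ; (suc zero) (s≤s ()) }

  monic-linProd : ∀ S → Monic (linProd S) (length S)
  monic-linProd []      = mkMonic refl λ { (suc j) _ → refl }
  monic-linProd (a ∷ S) = monic-mul (monic-linear a) (monic-linProd S)

  linProd-root⇒∈ : ∀ S a → eval (linProd S) a ≡ 0# → a ∈ S
  linProd-root⇒∈ []      a 1[a]≡0 =
    ⊥-elim (1≢0 (trans (sym (trans (cong (1# +_) (zeroʳ a)) (+-identityʳ 1#))) 1[a]≡0))
  linProd-root⇒∈ (b ∷ S) a root with no-zero-divisors (trans (sym (eval-mul (linear b) (linProd S) a)) root)
  ... | inj₁ a-b≡0 = here (x∙y⁻¹≈ε⇒x≈y _ _ (trans (sym (eval-linear b a)) a-b≡0))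
  ... | inj₂ S[a]≡0 = there (linProd-root⇒∈ S a S[a]≡0)

  ∈⇒linProd-root : ∀ S {a} → a ∈ S → eval (linProd S) a ≡ 0#
  ∈⇒linProd-root (b ∷ S) (here refl) = eval-linear-multiple b (linProd S)
  ∈⇒linProd-root (b ∷ S) {a} (there a∈S) =
    trans (eval-mul (linear b) (linProd S) a) (trans (cong (eval (linear b) a *_) (∈⇒linProd-root S a∈S)) (zeroʳ _))

  ⊆⇒linProd-divides : ∀ {S' S} → S' ⊆ S → ∃ λ H → linProd S ≋ mulP (linProd S') H
  ⊆⇒linProd-divides [] = oneP , ≋-sym (mul-identityʳ oneP)
  ⊆⇒linProd-divides {S'} (b ∷ʳ S'⊆S) with ⊆⇒linProd-divides S'⊆S
  ... | H , S≋S'H = mulP (linear b) H , ≋-trans (mul-congʳ (linear b) S≋S'H) (mul-left-comm (linear b) (linProd S') H)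
  ⊆⇒linProd-divides {b ∷ S'} (refl ∷ S'⊆S) with ⊆⇒linProd-divides S'⊆S
  ... | H , S≋S'H = H , ≋-trans (mul-congʳ (linear b) S≋S'H) (≋-sym (mul-assoc (linear b) (linProd S') H))

  scaled-linProd-lead : ∀ S c → coeff (scalP c (linProd S)) (length S) ≡ c
  scaled-linProd-lead S c =
    trans (coeff-scal c (linProd S) (length S)) (trans (cong (c *_) (Monic.lead≡1 (monic-linProd S))) (*-identityʳ c))

  scaled-linProd-deg : ∀ S {c} → c ≢ 0# → HasDeg (scalP c (linProd S)) (length S)
  scaled-linProd-deg S {c} c≢0 = mkDeg (λ lead≡0 → c≢0 (trans (sym (scaled-linProd-lead S c)) lead≡0))
    λ j |S|<j → trans (coeff-scal c (linProd S) j) (trans (cong (c *_) (Monic.vanish (monic-linProd S) j |S|<j)) (zeroʳ c))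

  divisor-of-constant : ∀ {c D H} → c ≢ 0# → mulP D H ≋ [ c ] → coeff D 0 ≢ 0# × D ≋ [ coeff D 0 ]
  divisor-of-constant {c} {D} {H} c≢0 DH≋c = HasDeg.lead≢0 D-deg0 ,
    mk≋ λ { zero → refl ; (suc j) → HasDeg.vanish D-deg0 (suc j) (s≤s z≤n) }
    where
    DH-deg0 : HasDeg (mulP D H) 0
    DH-deg0 = deg-cong (≋-sym DH≋c) (deg-const c≢0)
    D≉0 : ¬ (D ≋ [])
    D≉0 D≋0 = deg-nonzero DH-deg0 (mul-zeroˡ H D≋0)
    H≉0 : ¬ (H ≋ [])
    H≉0 H≋0 = deg-nonzero DH-deg0 (≋-trans (mul-congʳ D H≋0) (mul-zeroʳ D))
    dD = deg-exists D D≉0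
    dH = deg-exists H H≉0
    D-deg0 : HasDeg D 0
    D-deg0 = subst (HasDeg D)
      (ℕP.m+n≡0⇒m≡0 (proj₁ dD) (deg-unique (deg-mul (proj₂ dD) (proj₂ dH)) DH-deg0)) (proj₂ dD)

  product-root : ∀ {D H c} a P → mulP D H ≋ scalP c (mulP (linear a) P) → eval D a ≡ 0# ⊎ eval H a ≡ 0#
  product-root {D} {H} {c} a P DH≋caP = no-zero-divisors (trans (sym (eval-mul D H a)) (trans (eval-cong a DH≋caP)
    (trans (eval-scal c (mulP (linear a) P) a) (trans (cong (c *_) (eval-linear-multiple a P)) (zeroʳ c)))))

  cancel-root-left : ∀ a {D H c P} → eval D a ≡ 0# → mulP D H ≋ scalP c (mulP (linear a) P) →
    mulP (divLinear a D) H ≋ scalP c P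
  cancel-root-left a {D} {H} {c} {P} D[a]≡0 DH≋caP = linear-cancel a
    (≋-trans (≋-sym (mul-assoc (linear a) (divLinear a D) H))
    (≋-trans (mul-congˡ H (≋-sym (root⇒factor a D D[a]≡0))) (≋-trans DH≋caP (≋-sym (mul-scalʳ c (linear a) P)))))

  cancel-root-right : ∀ a {D H c P} → eval H a ≡ 0# → mulP D H ≋ scalP c (mulP (linear a) P) →
    mulP D (divLinear a H) ≋ scalP c P
  cancel-root-right a {D} {H} {c} {P} H[a]≡0 DH≋caP = linear-cancel a
    (≋-trans (mul-left-comm (linear a) D (divLinear a H))
    (≋-trans (mul-congʳ D (≋-sym (root⇒factor a H H[a]≡0))) (≋-trans DH≋caP (≋-sym (mul-scalʳ c (linear a) P)))))

  divisor-of-linProd : ∀ S {c D H} → c ≢ 0# → mulP D H ≋ scalP c (linProd S) →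
    ∃₂ λ S' e → S' ⊆ S × e ≢ 0# × D ≋ scalP e (linProd S')
  divisor-of-linProd [] {c} {D} c≢0 DH≋c with divisor-of-constant c≢0 (≋-trans DH≋c (scal-oneP c))
  ... | D₀≢0 , D≋D₀ = [] , coeff D 0 , [] , D₀≢0 , ≋-trans D≋D₀ (≋-sym (scal-oneP (coeff D 0)))
  divisor-of-linProd (a ∷ S) {c} {D} {H} c≢0 DH≋cS with product-root {D} {H} a (linProd S) DH≋cS
  ... | inj₁ D[a]≡0
    with divisor-of-linProd S {c} {divLinear a D} {H} c≢0 (cancel-root-left a {D} {H} {c} {linProd S} D[a]≡0 DH≋cS)
  ...   | S' , e , S'⊆S , e≢0 , D′≋eS' = a ∷ S' , e , refl ∷ S'⊆S , e≢0 ,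
          ≋-trans (root⇒factor a D D[a]≡0)
                  (≋-trans (mul-congʳ (linear a) D′≋eS') (mul-scalʳ e (linear a) (linProd S')))
  divisor-of-linProd (a ∷ S) {c} {D} {H} c≢0 DH≋cS | inj₂ H[a]≡0
    with divisor-of-linProd S {c} {D} {divLinear a H} c≢0 (cancel-root-right a {D} {H} {c} {linProd S} H[a]≡0 DH≋cS)
  ... | S' , e , S'⊆S , e≢0 , D≋eS' = S' , e , a ∷ʳ S'⊆S , e≢0 , D≋eS'

  monic-divisor-of-linProd : ∀ S {c D d H} → c ≢ 0# → Monic D d → Normal D → mulP D H ≋ scalP c (linProd S) →
    ∃ λ S' → S' ⊆ S × D ≡ norm (linProd S')
  monic-divisor-of-linProd S {c} {D} {d} c≢0 D-monic D-normal DH≋cS with divisor-of-linProd S c≢0 DH≋cS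
  ... | S' , e , S'⊆S , e≢0 , D≋eS' = S' , S'⊆S , trans (sym (normal⇒norm≡ D-normal)) (norm-cong D≋S')
    where
    d≡|S'| : d ≡ length S'
    d≡|S'| = deg-unique (monic-deg D-monic) (deg-cong (≋-sym D≋eS') (scaled-linProd-deg S' e≢0))
    -- comparing leading coefficients gives e = 1
    e≡1 : e ≡ 1#
    e≡1 = trans (sym (scaled-linProd-lead S' e))
      (trans (sym (at D≋eS' (length S'))) (trans (cong (coeff D) (sym d≡|S'|)) (Monic.lead≡1 D-monic)))
    D≋S' : D ≋ linProd S'
    D≋S' = ≋-trans D≋eS' (≋-trans (scal-cong e≡1 (≋-refl {linProd S'})) (scal-one (linProd S')))

  foldr-↭ : ∀ {A : Set} (f : A → Pol → Pol) z →
    (∀ x {p q} → p ≋ q → f x p ≋ f x q) → (∀ x y p → f x (f y p) ≋ f y (f x p)) →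
    ∀ {xs ys} → xs ↭ ys → foldr f z xs ≋ foldr f z ys
  foldr-↭ f z cong-f comm-f ↭.refl         = ≋-refl
  foldr-↭ f z cong-f comm-f (↭.prep x p)   = cong-f x (foldr-↭ f z cong-f comm-f p)
  foldr-↭ f z cong-f comm-f (↭.swap x y p) = ≋-trans (cong-f x (cong-f y (foldr-↭ f z cong-f comm-f p))) (comm-f x y _)
  foldr-↭ f z cong-f comm-f (↭.trans p q)  = ≋-trans (foldr-↭ f z cong-f comm-f p) (foldr-↭ f z cong-f comm-f q)

  subProducts : List Carrier → List Pol
  subProducts []      = [ oneP ]
  subProducts (b ∷ T) = map (λ P → norm (mulP (linear b) P)) (subProducts T) ++ subProducts T

  norm-oneP : norm oneP ≡ oneP
  norm-oneP = normal⇒norm≡ normal[ 1≢0 ]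

  norm-linear-norm : ∀ b P → norm (mulP (linear b) (norm P)) ≡ norm (mulP (linear b) P)
  norm-linear-norm b P = norm-cong (mul-congʳ (linear b) (norm-≋ P))

  subProducts-elim : ∀ T {D} → D ∈ subProducts T → ∃ λ S' → S' ⊆ T × D ≡ norm (linProd S')
  subProducts-elim []      (here refl) = [] , [] , sym norm-oneP
  subProducts-elim (b ∷ T) D∈ with ∈-++⁻ (map (λ P → norm (mulP (linear b) P)) (subProducts T)) D∈
  ... | inj₂ D∈′ with subProducts-elim T D∈′
  ...   | S' , S'⊆T , D≡ = S' , b ∷ʳ S'⊆T , D≡
  subProducts-elim (b ∷ T) D∈ | inj₁ D∈′ with ∈-map⁻ (λ P → norm (mulP (linear b) P)) D∈′
  ... | P , P∈ , refl with subProducts-elim T P∈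
  ...   | S' , S'⊆T , refl = b ∷ S' , refl ∷ S'⊆T , norm-linear-norm b (linProd S')

  subProducts-intro : ∀ {S' T} → S' ⊆ T → norm (linProd S') ∈ subProducts T
  subProducts-intro []          = here norm-oneP
  subProducts-intro (y ∷ʳ S'⊆T) = ∈-++⁺ʳ _ (subProducts-intro S'⊆T)
  subProducts-intro {y ∷ S'} {y ∷ T} (refl ∷ S'⊆T) =
    ∈-++⁺ˡ (subst (_∈ map (λ P → norm (mulP (linear y) P)) (subProducts T)) (norm-linear-norm y (linProd S'))
             (∈-map⁺ (λ P → norm (mulP (linear y) P)) (subProducts-intro S'⊆T)))

  subProducts-normal : ∀ T {D} → D ∈ subProducts T → Normal D
  subProducts-normal T D∈ with subProducts-elim T D∈
  ... | S' , _ , refl = norm-normal (linProd S')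

  subProducts-unique : ∀ T → Unique T → Unique (subProducts T)
  subProducts-unique []      _          = [] ∷ []
  subProducts-unique (b ∷ T) (b∉T ∷ uT) = Unique.++⁺ (unique-map-injectiveOn times-b injective IH) IH disjoint
    where
    IH = subProducts-unique T uT
    times-b = λ P → norm (mulP (linear b) P)
    injective : ∀ {x y} → x ∈ subProducts T → y ∈ subProducts T → times-b x ≡ times-b y → x ≡ y
    injective x∈ y∈ e = normal-≋⇒≡ (subProducts-normal T x∈) (subProducts-normal T y∈)
      (linear-cancel b (≋-trans (≋-sym (norm-≋ _)) (≋-trans (≡⇒≋ e) (norm-≋ _))))
    -- sub-products using b vanish at b, the others do not
    disjoint : Disjoint (map times-b (subProducts T)) (subProducts T)
    disjoint (D∈₁ , D∈₂) with ∈-map⁻ times-b D∈₁ | subProducts-elim T D∈₂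
    ... | P , _ , refl | S' , S'⊆T , e = All.lookup b∉T (Any-resp-⊆ S'⊆T (linProd-root⇒∈ S' b S'[b]≡0)) refl
      where
      S'[b]≡0 : eval (linProd S') b ≡ 0#
      S'[b]≡0 = trans (sym (eval-cong b (norm-≋ (linProd S'))))
        (trans (cong (λ w → eval w b) (sym e)) (trans (eval-cong b (norm-≋ (mulP (linear b) P))) (eval-linear-multiple b P)))

  sumP : List Pol → Pol
  sumP = foldr addP []

  sumP-++ : ∀ xs ys → sumP (xs ++ ys) ≋ addP (sumP xs) (sumP ys)
  sumP-++ []       ys = ≋-refl
  sumP-++ (x ∷ xs) ys = ≋-trans (addˡ-cong x (sumP-++ xs ys)) (≋-sym (add-assoc x (sumP xs) (sumP ys)))

  sumP-times-linear : ∀ b L → sumP (map (λ P → norm (mulP (linear b) P)) L) ≋ mulP (linear b) (sumP L)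
  sumP-times-linear b []      = ≋-sym (mul-zeroʳ (linear b))
  sumP-times-linear b (x ∷ L) =
    ≋-trans (add-cong (norm-≋ (mulP (linear b) x)) (sumP-times-linear b L)) (≋-sym (mul-distribˡ (linear b) x (sumP L)))

  sigmaValue : List Carrier → Pol
  sigmaValue = foldr (λ b acc → mulP (addP (linear b) oneP) acc) oneP

  sum-subProducts : ∀ T → sumP (subProducts T) ≋ sigmaValue T
  sum-subProducts []      = add-identityʳ oneP
  sum-subProducts (b ∷ T) = begin
    sumP (map times-b (subProducts T) ++ subProducts T)
      ≈⟨ sumP-++ (map times-b (subProducts T)) (subProducts T) ⟩
    addP (sumP (map times-b (subProducts T))) (sumP (subProducts T))
      ≈⟨ add-cong (sumP-times-linear b (subProducts T)) (≋-sym (mul-identityˡ (sumP (subProducts T)))) ⟩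
    addP (mulP (linear b) (sumP (subProducts T))) (mulP oneP (sumP (subProducts T)))
      ≈⟨ ≋-sym (mul-distribʳ (linear b) oneP (sumP (subProducts T))) ⟩
    mulP (addP (linear b) oneP) (sumP (subProducts T))
      ≈⟨ mul-congʳ (addP (linear b) oneP) (sum-subProducts T) ⟩
    mulP (addP (linear b) oneP) (sigmaValue T)
      ∎
    where
    open import Relation.Binary.Reasoning.Setoid ≋-setoid
    times-b = λ P → norm (mulP (linear b) P)

  module SplitDivisors (R : List Carrier) {d G} (uR : Unique R) (d≢0 : d ≢ 0#) (G≋dR : G ≋ scalP d (linProd R)) where

    G-deg : HasDeg G (length R)
    G-deg = deg-cong (≋-sym G≋dR) (scaled-linProd-deg R d≢0)

    divides-G = λ D → divides D G
    candidates = concatMap monicOfDeg (upTo (suc (deg G)))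

    divisor⇒subProduct : ∀ {D} → D ∈ monicDivisors G → D ∈ subProducts R
    divisor⇒subProduct {D} D∈ with ∈-filterᵇ⁻ divides-G D∈
    ... | D∈cand , D∣G with find (∈-concatMap⁻ monicOfDeg {xs = upTo (suc (deg G))} D∈cand) | divides-sound D G D∣G
    ...   | k , _ , D∈k | H , DH≋G with monicOfDeg-monic {k} D∈k
    ...     | D-normal , D-monic with monic-divisor-of-linProd R d≢0 D-monic D-normal (≋-trans DH≋G G≋dR)
    ...       | S' , S'⊆R , refl = subProducts-intro S'⊆R

    subProduct⇒divisor : ∀ {D} → D ∈ subProducts R → D ∈ monicDivisors G
    subProduct⇒divisor {D} D∈ with subProducts-elim R D∈
    ... | S' , S'⊆R , refl = ∈-filterᵇ⁺ divides-G D∈cand D∣G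
      where
      D-monic : Monic (norm (linProd S')) (length S')
      D-monic = monic-cong (≋-sym (norm-≋ (linProd S'))) (monic-linProd S')
      D∈cand : norm (linProd S') ∈ candidates
      D∈cand = ∈-concatMap⁺ monicOfDeg {xs = upTo (suc (deg G))}
        (Any.map (λ { refl → monic⇒∈monicOfDeg (norm-normal (linProd S')) D-monic })
                 (∈-upTo⁺ (s≤s (subst (length S' ≤_) (sym (deg≡ G-deg)) (length-mono-≤ S'⊆R)))))
      H = proj₁ (⊆⇒linProd-divides S'⊆R)
      -- G ≋ d · linProd R ≋ norm(linProd S') · (d · H)
      D∣G : T (divides (norm (linProd S')) G)
      D∣G = divides-complete (scalP d H) (monic-deg D-monic) G-deg
        (≋-trans (mul-scalʳ d (norm (linProd S')) H) (≋-trans (scal-cong refl (≋-trans (mul-congˡ H (norm-≋ (linProd S')))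
                 (≋-sym (proj₂ (⊆⇒linProd-divides S'⊆R))))) (≋-sym G≋dR)))

    monicDivisors-↭ : monicDivisors G ↭ subProducts R
    monicDivisors-↭ = unique-same-members⇒↭
      (filterᵇ-unique divides-G (candidates-unique (Unique.upTo⁺ (suc (deg G)))))
      (subProducts-unique R uR) divisor⇒subProduct subProduct⇒divisor

  sigma-split : ∀ R {d G} → Unique R → d ≢ 0# → G ≋ scalP d (linProd R) → sigmaT G ≋ sigmaValue R
  sigma-split R uR d≢0 G≋dR = ≋-trans
    (foldr-↭ addP [] addˡ-cong add-left-comm (SplitDivisors.monicDivisors-↭ R uR d≢0 G≋dR))
    (sum-subProducts R)

  linear-normal : ∀ a → Normal (linear a)
  linear-normal a = normal∷ normal[ 1≢0 ]

  linear-deg : ∀ a → HasDeg (linear a) 1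
  linear-deg a = monic-deg (monic-linear a)

  linear-injective : ∀ {a b} → linear a ≡ linear b → a ≡ b
  linear-injective e = -‿injective (List.∷-injectiveˡ e)

  -- isIrreducibleMonic only inspects divisors of degree strictly between 0 and deg P.
  deg1⇒irreducible : ∀ P → deg P ≡ 1 → T (isIrreducibleMonic P)
  deg1⇒irreducible P deg≡1 rewrite deg≡1 = _

  -- An irreducible monic polynomial of degree at least 2 has no divisor T - a: isIrreducibleMonic
  -- tests every monic candidate of degree 1.
  irreducible⇒no-linear-divisor : ∀ {P d} a → T (isIrreducibleMonic P) → HasDeg P (suc (suc d)) →
    ¬ T (divides (linear a) P)
  irreducible⇒no-linear-divisor {P} a irr P-deg =
    T-not⇒¬T (All.lookup (All.all⁺ _ _ (All.lookup degree-tests 1∈)) (monicOfDeg-intro [ - a ]))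
    where
    degree-tests = All.all⁺ _ _ (proj₂ (Equivalence.to T-∧ irr))
    1∈ : 1 ∈ applyUpTo suc (deg P ∸ 1)
    1∈ = ∈-applyUpTo⁺ suc (subst (λ n → 0 < n ∸ 1) (sym (deg≡ P-deg)) (s≤s z≤n))

  simple-root : ∀ S {c Y a} → Unique S → c ≢ 0# → a ∈ S →
    scalP c (linProd S) ≋ mulP (linear a) Y → eval Y a ≢ 0#
  simple-root (b ∷ S) {c} {Y} {a} (b∉S ∷ _) c≢0 (here refl) cS≋aY Y[a]≡0 = *-≢0 c≢0 S[a]≢0 cS[a]≡0
    where
    Y≋cS : Y ≋ scalP c (linProd S)
    Y≋cS = ≋-sym (linear-cancel a (≋-trans (mul-scalʳ c (linear a) (linProd S)) cS≋aY))
    S[a]≢0 : eval (linProd S) a ≢ 0#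
    S[a]≢0 S[a]≡0 = All.lookup b∉S (linProd-root⇒∈ S a S[a]≡0) refl
    cS[a]≡0 : c * eval (linProd S) a ≡ 0#
    cS[a]≡0 = trans (sym (trans (eval-cong a Y≋cS) (eval-scal c (linProd S) a))) Y[a]≡0
  simple-root (b ∷ S) {c} {Y} {a} (b∉S ∷ uS) c≢0 (there a∈S) cS≋aY Y[a]≡0 =
    simple-root S {c} {divLinear b Y} uS c≢0 a∈S cS≋aY′ Y′[a]≡0
    where
    a≢b : a ≢ b
    a≢b refl = All.lookup b∉S a∈S refl
    Y[b]≡0 : eval Y b ≡ 0#
    Y[b]≡0 with no-zero-divisors (trans (sym (eval-mul (linear a) Y b))
                 (trans (sym (eval-cong b cS≋aY)) (trans (eval-scal c (linProd (b ∷ S)) b)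
                 (trans (cong (c *_) (eval-linear-multiple b (linProd S))) (zeroʳ c)))))
    ... | inj₁ b-a≡0 = ⊥-elim (x-y≢0 (λ b≡a → a≢b (sym b≡a)) (trans (sym (eval-linear a b)) b-a≡0))
    ... | inj₂ Y[b]≡0 = Y[b]≡0
    Y′ = divLinear b Y
    Y≋bY′ : Y ≋ mulP (linear b) Y′
    Y≋bY′ = root⇒factor b Y Y[b]≡0
    cS≋aY′ : scalP c (linProd S) ≋ mulP (linear a) Y′
    cS≋aY′ = linear-cancel b (≋-trans (mul-scalʳ c (linear b) (linProd S))
      (≋-trans cS≋aY (≋-trans (mul-congʳ (linear a) Y≋bY′) (mul-left-comm (linear a) (linear b) Y′))))
    Y′[a]≡0 : eval Y′ a ≡ 0#
    Y′[a]≡0 with no-zero-divisors (trans (sym (eval-mul (linear b) Y′ a)) (trans (sym (eval-cong a Y≋bY′)) Y[a]≡0))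
    ... | inj₁ a-b≡0 = ⊥-elim (x-y≢0 a≢b (trans (sym (eval-linear b a)) a-b≡0))
    ... | inj₂ Y′[a]≡0 = Y′[a]≡0

  phiValue : List Carrier → Pol
  phiValue S = foldr (λ P acc → mulP (addP P (negP oneP)) acc) oneP (map linear S)

  module SplitPrimes (S : List Carrier) {c F} (uS : Unique S) (c≢0 : c ≢ 0#) (F≋cS : F ≋ scalP c (linProd S)) where

    F-deg : HasDeg F (length S)
    F-deg = deg-cong (≋-sym F≋cS) (scaled-linProd-deg S c≢0)

    deg-F : deg F ≡ length S
    deg-F = deg≡ F-deg

    linear∣F : ∀ {a} → a ∈ S → F ≋ mulP (linear a) (divLinear a F)
    linear∣F {a} a∈S = root⇒factor a F (trans (eval-cong a F≋cS)
      (trans (eval-scal c (linProd S) a) (trans (cong (c *_) (∈⇒linProd-root S a∈S)) (zeroʳ c))))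

    root⇒0<deg-F : ∀ {a} → a ∈ S → 0 < deg F
    root⇒0<deg-F a∈S = subst (0 <_) (sym deg-F) (nonempty a∈S)
      where
      nonempty : ∀ {x} {xs : List Carrier} → x ∈ xs → 0 < length xs
      nonempty (here _)  = s≤s z≤n
      nonempty (there _) = s≤s z≤n

    is-prime-divisor = λ P → isIrreducibleMonic P ∧ divides P F
    candidates = concatMap monicOfDeg (applyUpTo suc (deg F))

    linear⇒prime-divisor : ∀ {P} → P ∈ map linear S → P ∈ primeDivisors F
    linear⇒prime-divisor P∈ with ∈-map⁻ linear P∈
    ... | a , a∈S , refl = ∈-filterᵇ⁺ is-prime-divisor linear∈candidates
        (Equivalence.from T-∧ (deg1⇒irreducible (linear a) (deg≡ (linear-deg a)) ,
                               divides-complete (divLinear a F) (linear-deg a) F-deg (≋-sym (linear∣F a∈S))))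
      where
      linear∈candidates : linear a ∈ candidates
      linear∈candidates = ∈-concatMap⁺ monicOfDeg {xs = applyUpTo suc (deg F)}
        (Any.map (λ { refl → monicOfDeg-intro [ - a ] }) (∈-applyUpTo⁺ suc (root⇒0<deg-F a∈S)))

    -- A monic irreducible divisor P of F is norm (linProd S') for some S' ⊆ S; S' cannot be
    -- empty (P has positive degree) nor have two elements a ∷ b ∷ _ (then T - a is a proper divisor).
    prime-divisor⇒linear : ∀ {P} → P ∈ primeDivisors F → P ∈ map linear S
    prime-divisor⇒linear {P} P∈ with ∈-filterᵇ⁻ is-prime-divisor P∈
    ... | P∈cand , t with Equivalence.to T-∧ t
    ...   | P-irreducible , P∣F with find (∈-concatMap⁻ monicOfDeg {xs = applyUpTo suc (deg F)} P∈cand)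
    ...     | k , k∈ , P∈k with ∈-applyUpTo⁻ suc k∈ | divides-sound P F P∣F
    ...       | i , _ , refl | H , PH≋F with monicOfDeg-monic {suc i} P∈k
    ...         | P-normal , P-monic with monic-divisor-of-linProd S c≢0 P-monic P-normal (≋-trans PH≋F F≋cS)
    ...           | [] , _ , P≡1 = ⊥-elim (ℕP.0≢1+n (deg-unique (subst (λ Q → HasDeg Q 0) (sym (trans P≡1 norm-oneP))
                                                                 (deg-const 1≢0)) (monic-deg P-monic)))
    ...           | a ∷ [] , S'⊆S , P≡a =
      subst (_∈ map linear S) (sym P≡linear) (∈-map⁺ linear (Any-resp-⊆ S'⊆S (here refl)))
      where
      P≡linear : P ≡ linear a
      P≡linear = trans P≡a (trans (norm-cong (mul-identityʳ (linear a))) (normal⇒norm≡ (linear-normal a)))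
    ...           | a ∷ b ∷ S″ , _ , P≡ab = ⊥-elim (irreducible⇒no-linear-divisor a P-irreducible P-deg linear∣P)
      where
      P≋ab : P ≋ linProd (a ∷ b ∷ S″)
      P≋ab = ≋-trans (≡⇒≋ P≡ab) (norm-≋ _)
      P-deg : HasDeg P (length (a ∷ b ∷ S″))
      P-deg = deg-cong (≋-sym P≋ab) (monic-deg (monic-linProd (a ∷ b ∷ S″)))
      linear∣P : T (divides (linear a) P)
      linear∣P = divides-complete (linProd (b ∷ S″)) (linear-deg a) P-deg (≋-sym P≋ab)

    primeDivisors-↭ : primeDivisors F ↭ map linear S
    primeDivisors-↭ = unique-same-members⇒↭
      (filterᵇ-unique is-prime-divisor (candidates-unique
        (Unique.applyUpTo⁺₁ suc (deg F) (λ i<j _ 1+i≡1+j → ℕP.<⇒≢ i<j (ℕP.suc-injective 1+i≡1+j)))))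
      (Unique.map⁺ linear-injective uS) prime-divisor⇒linear linear⇒prime-divisor

    -- v_{T - a}(F) = 1: T - a divides F, and (T - a)² would give a double root.
    valuation-one : ∀ {a} → a ∈ S → val (linear a) F ≡ 1
    valuation-one {a} a∈S = subst (λ N → length (takeWhileᵇ divides-F (applyUpTo suc N)) ≡ 1)
      (ℕP.suc-pred (deg F) {{ℕ.>-nonZero (root⇒0<deg-F a∈S)}})
      (takeWhile-one divides-F (ℕ.pred (deg F)) linear∣F′ linear²∤F)
      where
      divides-F = λ k → divides (powP (linear a) k) F
      linear∣F′ : T (divides-F 1)
      linear∣F′ = divides-complete (divLinear a F) (deg-cong (≋-sym (mul-identityʳ (linear a))) (linear-deg a)) F-deg
        (≋-trans (mul-congˡ (divLinear a F) (mul-identityʳ (linear a))) (≋-sym (linear∣F a∈S)))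
      linear²∤F : ¬ T (divides-F 2)
      linear²∤F t with divides-sound (powP (linear a) 2) F t
      ... | H , a²H≋F = simple-root S {c} {Y} uS c≢0 a∈S cS≋aY Y[a]≡0
        where
        Y = mulP (mulP (linear a) oneP) H
        cS≋aY : scalP c (linProd S) ≋ mulP (linear a) Y
        cS≋aY = ≋-trans (≋-sym F≋cS) (≋-trans (≋-sym a²H≋F) (mul-assoc (linear a) (mulP (linear a) oneP) H))
        Y[a]≡0 : eval Y a ≡ 0#
        Y[a]≡0 = trans (eval-mul (mulP (linear a) oneP) H a)
          (trans (cong (_* eval H a) (eval-linear-multiple a oneP)) (zeroˡ _))

  foldr-congOn : ∀ {A : Set} (f g : A → Pol → Pol) z (xs : List A) →
    (∀ x {p q} → p ≋ q → g x p ≋ g x q) → (∀ {x} → x ∈ xs → ∀ p → f x p ≋ g x p) →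
    foldr f z xs ≋ foldr g z xs
  foldr-congOn f g z []       cong-g f≋g = ≋-refl
  foldr-congOn f g z (x ∷ xs) cong-g f≋g =
    ≋-trans (f≋g (here refl) (foldr f z xs)) (cong-g x (foldr-congOn f g z xs cong-g (λ x∈ → f≋g (there x∈))))

  phi-split : ∀ S {c F} → Unique S → c ≢ 0# → F ≋ scalP c (linProd S) → phiT F ≋ phiValue S
  phi-split S {c} {F} uS c≢0 F≋cS =
    ≋-trans (foldr-congOn factor simple-factor oneP (primeDivisors F) cong-simple valuation-simplifies)
            (foldr-↭ simple-factor oneP cong-simple comm-simple primeDivisors-↭)
    where
    open SplitPrimes S uS c≢0 F≋cS
    factor = λ P acc → mulP (mulP (powP P (val P F ∸ 1)) (addP P (negP oneP))) acc
    simple-factor = λ P acc → mulP (addP P (negP oneP)) acc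
    cong-simple : ∀ P {p q} → p ≋ q → simple-factor P p ≋ simple-factor P q
    cong-simple P = mul-congʳ (addP P (negP oneP))
    comm-simple : ∀ P Q p → simple-factor P (simple-factor Q p) ≋ simple-factor Q (simple-factor P p)
    comm-simple P Q = mul-left-comm (addP P (negP oneP)) (addP Q (negP oneP))
    -- on a prime divisor T - a the exponent v - 1 is 0
    valuation-simplifies : ∀ {P} → P ∈ primeDivisors F → ∀ p → factor P p ≋ simple-factor P p
    valuation-simplifies P∈ p with ∈-map⁻ linear (prime-divisor⇒linear P∈)
    ... | a , a∈S , refl = mul-congˡ p (≋-trans
      (≡⇒≋ (cong (λ k → mulP (powP (linear a) (k ∸ 1)) (addP (linear a) (negP oneP))) (valuation-one a∈S)))
      (mul-identityˡ _))

  two : Carrier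
  two = 1# + 1#

  +two-injective : ∀ {a b} → a + two ≡ b + two → a ≡ b
  +two-injective {a} {b} = +-cancelʳ two a b

  -- The shift by 2 matches the two products factor by factor: -a - 1 = -(a + 2) + 1.
  phiValue≋sigmaValue : ∀ S → phiValue S ≋ sigmaValue (map (_+ two) S)
  phiValue≋sigmaValue []      = ≋-refl
  phiValue≋sigmaValue (a ∷ S) = mul-cong (∷-cong constant-term (≋-refl {[ 1# ]})) (phiValue≋sigmaValue S)
    where
    constant-term : - a + - 1# ≡ - (a + two) + 1#
    constant-term = sym (begin
      - (a + two) + 1#                ≡⟨ cong (_+ 1#) (sym (-‿+-comm a two)) ⟩
      (- a + - two) + 1#              ≡⟨ +-assoc (- a) (- two) 1# ⟩
      - a + (- two + 1#)              ≡⟨ cong (λ z → - a + (z + 1#)) (sym (-‿+-comm 1# 1#)) ⟩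
      - a + ((- 1# + - 1#) + 1#)      ≡⟨ cong (- a +_) (+-assoc (- 1#) (- 1#) 1#) ⟩
      - a + (- 1# + (- 1# + 1#))      ≡⟨ cong (λ z → - a + (- 1# + z)) (-‿inverseˡ 1#) ⟩
      - a + (- 1# + 0#)               ≡⟨ cong (- a +_) (+-identityʳ (- 1#)) ⟩
      - a + - 1#                      ∎)
      where open ≡-Reasoning

  units : List Carrier
  units = filterᵇ (λ a → not (a == 0#)) elems

  units-≢0 : ∀ {c} → c ∈ units → c ≢ 0#
  units-≢0 c∈ c≡0 = T-not⇒¬T (proj₂ (∈-filterᵇ⁻ (λ a → not (a == 0#)) {xs = elems} c∈)) (≡⇒== c≡0)

  size∸1≤units : size ∸ 1 ≤ length units
  size∸1≤units = ℕP.∸-monoˡ-≤ 1 (unique-length-≤ elems-unique elem∈0∷units)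
    where
    elem∈0∷units : ∀ {x} → x ∈ elems → x ∈ 0# ∷ units
    elem∈0∷units {x} x∈ with x ≟ 0#
    ... | yes x≡0 = here x≡0
    ... | no x≢0  = there (∈-filterᵇ⁺ (λ a → not (a == 0#)) x∈ (≢⇒not== x≢0))

  normal⇒∈polysOfDeg : ∀ {P d} → Normal P → HasDeg P d → P ∈ polysOfDeg d
  normal⇒∈polysOfDeg {P} {d} nf hd with normal-snoc nf hd
  ... | ys , z , refl , len , z≢0 =
    ∈-concatMap⁺ (λ xs → map (λ a → xs ++ [ a ]) units) {xs = vecs d}
      (Any.map (λ { refl → ∈-map⁺ (λ a → ys ++ [ a ]) (∈-filterᵇ⁺ _ (elems-complete z) (≢⇒not== z≢0)) })
               (vecs-complete d ys len))

  module GoodPairs (n : ℕ) where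

    Index = List Carrier × Carrier × Carrier

    indices : List Index
    indices = cartesianProduct (choose n elems) (cartesianProduct units units)

    pairOf : Index → Pol × Pol
    pairOf (S , c , d) = norm (scalP c (linProd S)) , norm (scalP d (linProd (map (_+ two) S)))

    goodPairs : List (Pol × Pol)
    goodPairs = filterᵇ (λ FG → eqP (phiT (proj₁ FG)) (sigmaT (proj₂ FG)))
                        (cartesianProduct (polysOfDeg n) (polysOfDeg n))

    index-members : ∀ {S c d} → (S , c , d) ∈ indices → S ∈ choose n elems × c ∈ units × d ∈ units
    index-members S,c,d∈ with ∈-cartesianProduct⁻ (choose n elems) _ S,c,d∈
    ... | S∈ , c,d∈ = S∈ , ∈-cartesianProduct⁻ units units c,d∈

    -- norm (c · linProd S) determines c (its leading coefficient) and then linProd S.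
    scaled-linProd-injective : ∀ {S S' c c'} → length S ≡ length S' → c ≢ 0# →
      norm (scalP c (linProd S)) ≡ norm (scalP c' (linProd S')) → c ≡ c' × linProd S ≋ linProd S'
    scaled-linProd-injective {S} {S'} {c} {c'} |S|≡|S'| c≢0 e =
      c≡c' , scal-cancel c≢0 (≋-trans cS≋c'S' (scal-cong (sym c≡c') ≋-refl))
      where
      cS≋c'S' : scalP c (linProd S) ≋ scalP c' (linProd S')
      cS≋c'S' = ≋-trans (≋-sym (norm-≋ _)) (≋-trans (≡⇒≋ e) (norm-≋ _))
      c≡c' : c ≡ c'
      c≡c' = trans (sym (scaled-linProd-lead S c)) (trans (at cS≋c'S' (length S))
        (trans (cong (coeff (scalP c' (linProd S'))) |S|≡|S'|) (scaled-linProd-lead S' c')))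

    same-roots : ∀ {S S'} → linProd S ≋ linProd S' → ∀ {a} → a ∈ S → a ∈ S'
    same-roots {S} {S'} e {a} a∈S = linProd-root⇒∈ S' a (trans (sym (eval-cong a e)) (∈⇒linProd-root S a∈S))

    -- F recovers c and S (S is a sublist of the duplicate-free elems), then G recovers d.
    pairOf-injective : ∀ {x y} → x ∈ indices → y ∈ indices → pairOf x ≡ pairOf y → x ≡ y
    pairOf-injective {S , c , d} {S' , c' , d'} x∈ y∈ e with index-members x∈ | index-members y∈
    ... | S∈ , c∈ , d∈ | S'∈ , _ , _
      with scaled-linProd-injective {S} {S'} {c} {c'} (trans (choose-length n elems S∈) (sym (choose-length n elems S'∈)))
             (units-≢0 c∈) (cong proj₁ e)
    ...   | refl , S≋S'
      with ⊆-extensional elems-unique (choose-⊆ n elems S∈) (choose-⊆ n elems S'∈) (same-roots S≋S') (same-roots (≋-sym S≋S'))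
    ...     | refl with scaled-linProd-injective {map (_+ two) S} {map (_+ two) S} {d} {d'} refl (units-≢0 d∈) (cong proj₂ e)
    ...       | refl , _ = refl

    scaled-linProd∈polysOfDeg : ∀ R {e} → e ≢ 0# → length R ≡ n → norm (scalP e (linProd R)) ∈ polysOfDeg n
    scaled-linProd∈polysOfDeg R {e} e≢0 |R|≡n = normal⇒∈polysOfDeg (norm-normal (scalP e (linProd R)))
      (deg-cong (≋-sym (norm-≋ (scalP e (linProd R)))) (subst (HasDeg (scalP e (linProd R))) |R|≡n (scaled-linProd-deg R e≢0)))

    pairOf-good : ∀ {x} → x ∈ indices → pairOf x ∈ goodPairs
    pairOf-good {S , c , d} x∈ with index-members x∈
    ... | S∈ , c∈ , d∈ = ∈-filterᵇ⁺ _ (∈-cartesianProduct⁺ F∈ G∈) (eqP-complete _ _ φ̃F≋σ̃G)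
      where
      S+2 = map (_+ two) S
      |S|≡n : length S ≡ n
      |S|≡n = choose-length n elems S∈
      uS : Unique S
      uS = unique-⊆ (choose-⊆ n elems S∈) elems-unique
      F∈ = scaled-linProd∈polysOfDeg S (units-≢0 c∈) |S|≡n
      G∈ = scaled-linProd∈polysOfDeg S+2 (units-≢0 d∈) (trans (List.length-map (_+ two) S) |S|≡n)
      φ̃F≋σ̃G : phiT (norm (scalP c (linProd S))) ≋ sigmaT (norm (scalP d (linProd S+2)))
      φ̃F≋σ̃G = ≋-trans (phi-split S uS (units-≢0 c∈) (norm-≋ _)) (≋-trans (phiValue≋sigmaValue S)
        (≋-sym (sigma-split S+2 (Unique.map⁺ +two-injective uS) (units-≢0 d∈) (norm-≋ _))))

    countPairs-lower-bound : binomial size n ℕ.* ((size ∸ 1) ℕ.* (size ∸ 1)) ≤ Defs.countPairs 𝔽 n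
    countPairs-lower-bound = ℕP.≤-trans count-indices
      (unique-length-≤ (unique-map-injectiveOn pairOf pairOf-injective unique-indices) (λ p∈ → pairOf-in-good p∈))
      where
      open ℕP.≤-Reasoning
      unique-indices : Unique indices
      unique-indices = Unique.cartesianProduct⁺ (choose-unique n elems elems-unique)
        (Unique.cartesianProduct⁺ (filterᵇ-unique _ elems-unique) (filterᵇ-unique _ elems-unique))
      pairOf-in-good : ∀ {p} → p ∈ map pairOf indices → p ∈ goodPairs
      pairOf-in-good p∈ with ∈-map⁻ pairOf p∈
      ... | x , x∈ , refl = pairOf-good x∈
      count-indices : binomial size n ℕ.* ((size ∸ 1) ℕ.* (size ∸ 1)) ≤ length (map pairOf indices)
      count-indices = begin
        binomial size n ℕ.* ((size ∸ 1) ℕ.* (size ∸ 1))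
          ≤⟨ ℕP.*-monoʳ-≤ (binomial size n) (ℕP.*-mono-≤ size∸1≤units size∸1≤units) ⟩
        binomial size n ℕ.* (length units ℕ.* length units)
          ≡⟨ cong₂ ℕ._*_ (sym (length-choose n elems)) (sym (length-cartesianProduct units units)) ⟩
        length (choose n elems) ℕ.* length (cartesianProduct units units)
          ≡⟨ sym (length-cartesianProduct (choose n elems) _) ⟩
        length indices
          ≡⟨ sym (List.length-map pairOf indices) ⟩
        length (map pairOf indices) ∎

open import Data.Nat using (_+_; _*_; _^_)

binomial-monoˡ : ∀ {q q'} k → q ≤ q' → binomial q k ≤ binomial q' k
binomial-monoˡ zero    _         = ℕP.≤-refl
binomial-monoˡ (suc k) z≤n       = z≤n
binomial-monoˡ (suc k) (s≤s q≤q') = ℕP.+-mono-≤ (binomial-monoˡ k q≤q') (binomial-monoˡ (suc k) q≤q')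

-- Choosing the first element among m candidates: m · C(q - m, k) ≤ C(q, k + 1).
binomial-step : ∀ m q k → m ≤ q → m * binomial (q ∸ m) k ≤ binomial q (suc k)
binomial-step zero    q       k _         = z≤n
binomial-step (suc m) (suc q) k (s≤s m≤q) =
  ℕP.+-mono-≤ (binomial-monoˡ k (ℕP.m∸n≤m q m)) (binomial-step m q k m≤q)

power-≤-binomial : ∀ k m q → k * m ≤ q → m ^ k ≤ binomial q k
power-≤-binomial zero    m q _     = ℕP.≤-refl
power-≤-binomial (suc k) m q [k+1]m≤q = begin
  m * m ^ k                ≤⟨ ℕP.*-monoʳ-≤ m (power-≤-binomial k m (q ∸ m) km≤q∸m) ⟩
  m * binomial (q ∸ m) k   ≤⟨ binomial-step m q k (ℕP.≤-trans (ℕP.m≤m+n m (k * m)) [k+1]m≤q) ⟩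
  binomial q (suc k)       ∎
  where
  open ℕP.≤-Reasoning
  km≤q∸m : k * m ≤ q ∸ m
  km≤q∸m = subst (_≤ q ∸ m) (ℕP.m+n∸m≡n m (k * m)) (ℕP.∸-monoˡ-≤ m [k+1]m≤q)

floor-quotient : ∀ n q .{{_ : ℕ.NonZero n}} → n ≤ q → n * (q / n) ≤ q × q ≤ 2 * n * (q / n)
floor-quotient n q n≤q = nm≤q , q≤2nm
  where
  m = q / n
  open ℕP.≤-Reasoning
  nm≤q : n * m ≤ q
  nm≤q = subst (_≤ q) (ℕP.*-comm m n) (m/n*n≤m q n)
  q≤2nm : q ≤ 2 * n * m
  q≤2nm = begin
    q                   ≡⟨ m≡m%n+[m/n]*n q n ⟩
    q % n + m * n       ≤⟨ ℕP.+-monoˡ-≤ (m * n) (ℕP.<⇒≤ (m%n<n q n)) ⟩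
    n + m * n           ≤⟨ ℕP.+-monoˡ-≤ (m * n) (ℕP.m≤n*m n m {{ℕ.>-nonZero (m≥n⇒m/n>0 n≤q)}}) ⟩
    m * n + m * n       ≡⟨ cong (m * n +_) (sym (ℕP.+-identityʳ (m * n))) ⟩
    2 * (m * n)         ≡⟨ cong (2 *_) (ℕP.*-comm m n) ⟩
    2 * (n * m)         ≡⟨ sym (ℕP.*-assoc 2 n m) ⟩
    2 * n * m           ∎

power-≤-binomial-square : ∀ n q .{{_ : ℕ.NonZero n}} → (2 * n) ^ n + n ≤ q →
  q ^ n ≤ binomial q n * ((q ∸ 1) * (q ∸ 1))
power-≤-binomial-square n q big = begin
  q ^ n                                 ≤⟨ ℕP.^-monoˡ-≤ n q≤2nm ⟩
  (2 * n * m) ^ n                       ≡⟨ *-^-distrib (2 * n) m n ⟩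
  (2 * n) ^ n * m ^ n                   ≤⟨ ℕP.*-mono-≤ [2n]^n≤[q-1]² (power-≤-binomial n m q nm≤q) ⟩
  (q ∸ 1) * (q ∸ 1) * binomial q n      ≡⟨ ℕP.*-comm _ (binomial q n) ⟩
  binomial q n * ((q ∸ 1) * (q ∸ 1))    ∎
  where
  open ℕP.≤-Reasoning
  m = q / n
  bounds = floor-quotient n q (ℕP.≤-trans (ℕP.m≤n+m n ((2 * n) ^ n)) big)
  nm≤q = proj₁ bounds
  q≤2nm = proj₂ bounds
  [2n]^n>0 : 0 < (2 * n) ^ n
  [2n]^n>0 = ℕP.m^n>0 (2 * n) {{ℕP.m*n≢0 2 n}} n
  [2n]^n≤q-1 : (2 * n) ^ n ≤ q ∸ 1
  [2n]^n≤q-1 = ℕP.≤-trans (ℕP.≤-reflexive (sym (ℕP.m+n∸n≡m ((2 * n) ^ n) 1)))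
                 (ℕP.∸-monoˡ-≤ 1 (ℕP.≤-trans (ℕP.+-monoʳ-≤ ((2 * n) ^ n) (ℕ.>-nonZero⁻¹ n)) big))
  [2n]^n≤[q-1]² : (2 * n) ^ n ≤ (q ∸ 1) * (q ∸ 1)
  [2n]^n≤[q-1]² = ℕP.≤-trans [2n]^n≤q-1
    (ℕP.m≤m*n (q ∸ 1) (q ∸ 1) {{ℕ.>-nonZero (ℕP.≤-trans [2n]^n>0 [2n]^n≤q-1)}})
  *-^-distrib : ∀ a b k → (a * b) ^ k ≡ a ^ k * b ^ k
  *-^-distrib a b zero    = refl
  *-^-distrib a b (suc k) =
    trans (cong ((a * b) *_) (*-^-distrib a b k)) (ℕP.[m*n]*[o*p]≡[m*o]*[n*p] a b (a ^ k) (b ^ k))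

-- Theorem 1.6 with K = 1 and Q₀ = (2n)^n + n: already q^n ≤ countPairs n, and n² ≥ 1.
theorem1p6 : ∃ λ (K : ℕ) → ∀ (n : ℕ) → 1 ≤ n → ∃ λ (Q₀ : ℕ) →
    ∀ (𝔽 : FiniteField) → Q₀ ≤ FiniteField.size 𝔽 →
    FiniteField.size 𝔽 ^ n ≤ K * (n * n) * countPairs 𝔽 n
theorem1p6 = 1 , λ n 1≤n → (2 * n) ^ n + n , λ 𝔽 q-large → bound n 1≤n 𝔽 q-large
  where
  bound : ∀ n → 1 ≤ n → ∀ 𝔽 → (2 * n) ^ n + n ≤ FiniteField.size 𝔽 →
    FiniteField.size 𝔽 ^ n ≤ 1 * (n * n) * countPairs 𝔽 n
  bound n 1≤n 𝔽 q-large = begin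
    q ^ n                                ≤⟨ power-≤-binomial-square n q {{ℕ.>-nonZero 1≤n}} q-large ⟩
    binomial q n * ((q ∸ 1) * (q ∸ 1))   ≤⟨ Polynomials.GoodPairs.countPairs-lower-bound 𝔽 n ⟩
    countPairs 𝔽 n                       ≤⟨ ℕP.m≤n*m (countPairs 𝔽 n) (1 * (n * n)) {{ℕ.>-nonZero 0<n²}} ⟩
    1 * (n * n) * countPairs 𝔽 n         ∎
    where
    open ℕP.≤-Reasoning
    q = FiniteField.size 𝔽
    0<n² : 0 < 1 * (n * n)
    0<n² = ℕP.*-monoʳ-≤ 1 (ℕP.*-mono-≤ 1≤n 1≤n)
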